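{- Let $n$ be a positive integer. (i) If $n$ is even and $h_1:\mathbb{F}_{2^n}\to\mathbb{F}_{2^n}$ is $h_1(x)=x^{2^n-2}$, then \[ 2^n-\sqrt{2}\cdot 2^{n/2}-\tfrac{3}{2}\leq d_H(h_1,\mathcal{A})\leq 2^n-2^{n/2}-2. \] (ii) If $n$ is divisible by $4$, $d=2^{n/2-1}+1$ and $h_2(x)=x^d$ on $\mathbb{F}_{2^n}$, then \[ 2^n-\sqrt{2}\cdot 2^{n/2}-\tfrac{1}{2}\leq d_H(h_2,\mathcal{A})\leq 2^n-2^{n/2}-2. \] In particular, $d_H(h_i,\mathcal{A})\leq 2^n-2^{n/2}-1$ for $i=1,2$ under the respective hypotheses.
   Context: $\mathbb{F}_{2^n}$ is viewed as the $\mathbb{F}_2$-vector space $\mathbb{F}_2^n$. For functions $f,g:\mathbb{F}_{2^n}\to\mathbb{F}_{2^n}$, $d_H(f,g)$ is the number of $x$ with $f(x)\neq g(x)$. $\mathcal{A}$ is the set of affine maps $\mathbb{F}_{2^n}\to\mathbb{F}_{2^n}$ (an $\mathbb{F}_2$-linear map plus a constant), and $d_H(f,\mathcal{A})=\min_{A\in\mathcal{A}}d_H(f,A)$. -}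

module Defs where

open import Level using (0ℓ)
open import Data.Nat as ℕ using (ℕ; zero; suc; _^_; _/_)
open import Data.Integer as ℤ using (ℤ; +_; _-_; _≤_)
import Data.Integer
open import Data.List using (List; length; filter)
open import Data.List.Membership.Propositional using (_∈_)
open import Data.List.Relation.Unary.Unique.Propositional using (Unique)
open import Data.Sum using (_⊎_)
open import Data.Product using (Σ; ∃; _×_)
open import Relation.Nullary using (¬_; ¬?)
open import Relation.Binary using (DecidableEquality)
open import Relation.Binary.PropositionalEquality using (_≡_; _≢_)
open import Algebra.Structures using (IsCommutativeRing)

-- A finite field with exactly 2^n elements (a model of 𝔽_{2^n};
-- all such fields are isomorphic, so quantifying over them is faithful).
record BinaryField (n : ℕ) : Set₁ where
  infixl 6 _+_
  infixl 7 _*_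
  field
    Carrier   : Set
    _≟_       : DecidableEquality Carrier
    _+_ _*_   : Carrier → Carrier → Carrier
    -_        : Carrier → Carrier
    0# 1#     : Carrier
    isCommutativeRing : IsCommutativeRing _≡_ _+_ _*_ -_ 0# 1#
    0≢1       : 0# ≢ 1#
    inverse   : ∀ x → x ≢ 0# → ∃ λ y → x * y ≡ 1#
    elements  : List Carrier
    unique    : Unique elements
    complete  : ∀ x → x ∈ elements
    size      : length elements ≡ 2 ^ n

  pow : Carrier → ℕ → Carrier
  pow x zero    = 1#
  pow x (suc k) = x * pow x k

  -- F₂-linear maps (over F₂, linearity = additivity)
  IsLinear : (Carrier → Carrier) → Set
  IsLinear L = ∀ x y → L (x + y) ≡ L x + L y

  dH : (Carrier → Carrier) → (Carrier → Carrier) → ℕ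
  dH f g = length (filter (λ x → ¬? (f x ≟ g x)) elements)

  -- d_H(f, 𝒜) ≤ b : some affine map x ↦ L x + c is within distance b
  dHA≤ : (Carrier → Carrier) → ℤ → Set
  dHA≤ f b = Σ (Carrier → Carrier) λ L → IsLinear L × Σ Carrier λ c →
               + dH f (λ x → L x + c) ≤ b

  -- P (d_H(f, 𝒜)) : property holds at every affine map's distance,
  -- i.e. a lower-bound predicate P (monotone) holds for the minimum
  dHA-all : (Carrier → Carrier) → (ℕ → Set) → Set
  dHA-all f P = ∀ (L : Carrier → Carrier) → IsLinear L → ∀ (c : Carrier) →
                  P (dH f (λ x → L x + c))

-- a ≤ √2 · b  (for a ∈ ℤ, b ∈ ℕ), written out exactly over the integers
_≤√2·_ : ℤ → ℕ → Set
a ≤√2· b = a ≤ + 0 ⊎ a Data.Integer.* a ≤ + (2 ℕ.* b ℕ.* b)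

-- 2^n − √2·2^{n/2} − k/2 ≤ d   ⇔   2·(2^n − d) − k ≤ √2 · 2^{n/2+1}
LowerBound : (n k d : ℕ) → Set
LowerBound n k d = (+ 2 Data.Integer.* (+ (2 ^ n) - + d) - + k) ≤√2· (2 ^ (n / 2) ℕ.* 2)

-- If f agrees with the affine map L + c on N points, any two of them, x and x + a,
-- satisfy f x + f (x + a) = L a; counting these ordered pairs by their difference a gives
-- N² ≤ N + Σ_{a ≠ 0} #{x | f x + f (x + a) = L a}. For the Gold map x^(2^k+1) (k odd, n = 2k + 2)
-- each such equation has at most 2 solutions; for the inverse it has at most 2, plus 2 more exactly
-- when a · L a = 1, and the number C of such a is below the number of points where the inverse
-- agrees with L itself. Solving the resulting quadratic inequalities in N gives the bounds.
--
-- With q = 2^(n/2), the inverse agrees with x ↦ x^q, and the Gold map with the square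
-- root x ↦ x^(2^(n−1)), at 0 and on the unit circle U = {u | u^(q+1) = 1}. The norm x ↦ x^(q+1)
-- maps the q² − 1 nonzero elements to roots of y^(q−1) = 1, of which there are at most q − 1, with
-- fibres of size at most |U|; hence |U| ≥ q + 1 and the affine map misses at most 2ⁿ − q − 2 points.
module Submission where

open import Defs
open import Data.Nat as ℕ using (ℕ; zero; suc; _^_; _/_; _∸_; _≤_; _<_; _>_; z≤n; s≤s)
import Data.Nat.Properties as ℕ
open import Data.List using (List; []; _∷_; length; filter; map; foldr; replicate; _++_)
open import Data.List.Properties using (length-map; length-++; length-replicate; filter-notAll; filter-none; map-cong)
open import Data.List.Membership.Propositional using (_∈_)
open import Data.List.Membership.Propositional.Properties using (∈-filter⁺; ∈-filter⁻; ∈-map⁺; ∈-map⁻)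
open import Data.List.Membership.Propositional.Properties.WithK using (unique∧set⇒bag)
open import Data.List.Relation.Binary.BagAndSetEquality using (∼bag⇒↭)
open import Data.List.Relation.Binary.Permutation.Propositional using (_↭_)
import Data.List.Relation.Binary.Permutation.Propositional.Properties as ↭
open import Data.List.Relation.Binary.Subset.Propositional using (_⊆_)
open import Data.List.Relation.Unary.Any using (here; there)
import Data.List.Relation.Unary.Any as Any
import Data.List.Relation.Unary.All as All
open import Data.List.Relation.Unary.AllPairs using (_∷_)
open import Data.List.Relation.Unary.Unique.Propositional using (Unique)
import Data.List.Relation.Unary.Unique.Propositional.Properties as Unique
open import Data.Nat.ListAction using (sum)
open import Data.Nat.ListAction.Properties using (sum-↭)
open import Data.Product using (_,_; proj₁; proj₂)
open import Data.Sum using (_⊎_; inj₁; inj₂; [_,_]′)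
open import Data.Empty using (⊥-elim)
open import Function using (_∘_; mk⇔)
open import Relation.Nullary using (Dec; yes; no; ¬_; ¬?; _×-dec_; _⊎-dec_)
open import Relation.Unary using (Pred; Decidable)
open import Relation.Binary using (DecidableEquality)
open import Relation.Binary.PropositionalEquality
open import Level using (0ℓ)
open import Algebra.Bundles using (CommutativeRing)
open import Algebra.Structures using (IsCommutativeRing)

module Counting where
  open import Data.Nat using (_+_; _*_)
  open import Algebra.Properties.CommutativeSemigroup ℕ.+-commutativeSemigroup using (interchange)

  private variable
    A B : Set

  ∑ : List A → (A → ℕ) → ℕ
  ∑ xs f = sum (map f xs)

  syntax ∑ xs (λ x → e) = ∑[ x ∈ xs ] e

  ∑-+ : ∀ (f g : A → ℕ) xs → ∑[ x ∈ xs ] (f x + g x) ≡ ∑ xs f + ∑ xs g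
  ∑-+ f g []       = refl
  ∑-+ f g (x ∷ xs) = trans (cong (f x + g x +_) (∑-+ f g xs))
                           (interchange (f x) (g x) (∑ xs f) (∑ xs g))

  ∑-const : ∀ k (xs : List A) → ∑[ x ∈ xs ] k ≡ length xs * k
  ∑-const k []       = refl
  ∑-const k (x ∷ xs) = cong (k +_) (∑-const k xs)

  ∑-mono-≤ : ∀ {f g : A → ℕ} xs → (∀ {x} → x ∈ xs → f x ≤ g x) → ∑ xs f ≤ ∑ xs g
  ∑-mono-≤ []       f≤g = z≤n
  ∑-mono-≤ (x ∷ xs) f≤g = ℕ.+-mono-≤ (f≤g (here refl)) (∑-mono-≤ xs (f≤g ∘ there))

  ∑-comm : ∀ (f : A → B → ℕ) xs ys →
           ∑[ x ∈ xs ] ∑[ y ∈ ys ] f x y ≡ ∑[ y ∈ ys ] ∑[ x ∈ xs ] f x y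
  ∑-comm f []       ys = sym (trans (∑-const 0 ys) (ℕ.*-zeroʳ (length ys)))
  ∑-comm f (x ∷ xs) ys = trans (cong (∑ ys (f x) +_) (∑-comm f xs ys))
                               (sym (∑-+ (f x) (λ y → ∑[ x ∈ xs ] f x y) ys))

  ∑-cong : ∀ {f g : A → ℕ} xs → (∀ x → f x ≡ g x) → ∑ xs f ≡ ∑ xs g
  ∑-cong xs f≗g = cong sum (map-cong f≗g xs)

  ∑-↭ : ∀ (f : A → ℕ) {xs ys} → xs ↭ ys → ∑ xs f ≡ ∑ ys f
  ∑-↭ f = sum-↭ ∘ ↭.map⁺ f

  ∑-*ˡ : ∀ k (f : A → ℕ) xs → ∑[ x ∈ xs ] (k * f x) ≡ k * ∑ xs f
  ∑-*ˡ k f []       = sym (ℕ.*-zeroʳ k)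
  ∑-*ˡ k f (x ∷ xs) = trans (cong (k * f x +_) (∑-*ˡ k f xs)) (sym (ℕ.*-distribˡ-+ k (f x) (∑ xs f)))

  𝟙 : {P : Set} → Dec P → ℕ
  𝟙 (yes _) = 1
  𝟙 (no _)  = 0

  module _ {P : Pred A 0ℓ} (P? : Decidable P) where

    count : List A → ℕ
    count xs = length (filter P? xs)

    count≡∑𝟙 : ∀ xs → count xs ≡ ∑[ x ∈ xs ] 𝟙 (P? x)
    count≡∑𝟙 []       = refl
    count≡∑𝟙 (x ∷ xs) with P? x
    ... | yes _ = cong suc (count≡∑𝟙 xs)
    ... | no _  = count≡∑𝟙 xs

    count+count-∁ : ∀ xs → count xs + length (filter (¬? ∘ P?) xs) ≡ length xs
    count+count-∁ []       = refl
    count+count-∁ (x ∷ xs) with P? x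
    ... | yes _ = cong suc (count+count-∁ xs)
    ... | no _  = trans (ℕ.+-suc _ _) (cong suc (count+count-∁ xs))

    count-map : ∀ (f : B → A) xs → count (map f xs) ≡ length (filter (P? ∘ f) xs)
    count-map f []       = refl
    count-map f (x ∷ xs) with P? (f x)
    ... | yes _ = cong suc (count-map f xs)
    ... | no _  = count-map f xs

    count-↭ : ∀ {xs ys} → xs ↭ ys → count xs ≡ count ys
    count-↭ = ↭.↭-length ∘ ↭.filter-↭ P?

  module _ {P Q : Pred A 0ℓ} (P? : Decidable P) (Q? : Decidable Q) where

    count-filter : ∀ xs → count Q? (filter P? xs) ≡ count (λ x → P? x ×-dec Q? x) xs
    count-filter []       = refl
    count-filter (x ∷ xs) with P? x
    ... | no _  = count-filter xs
    ... | yes _ with Q? x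
    ...   | yes _ = cong suc (count-filter xs)
    ...   | no _  = count-filter xs

    count-mono : (∀ {x} → P x → Q x) → ∀ xs → count P? xs ≤ count Q? xs
    count-mono P⇒Q []       = z≤n
    count-mono P⇒Q (x ∷ xs) with P? x | Q? x
    ... | yes _ | yes _  = s≤s (count-mono P⇒Q xs)
    ... | yes p | no ¬q  = ⊥-elim (¬q (P⇒Q p))
    ... | no _  | yes _  = ℕ.m≤n⇒m≤1+n (count-mono P⇒Q xs)
    ... | no _  | no _   = count-mono P⇒Q xs

  module _ (_≟_ : DecidableEquality A) where

    length-mono-⊆ : ∀ {xs ys} → Unique xs → xs ⊆ ys → length xs ≤ length ys
    length-mono-⊆ {[]}     _            _     = z≤n
    length-mono-⊆ {x ∷ xs} {ys} (x∉xs ∷ xs!) xs⊆ys =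
      ℕ.≤-trans (s≤s (length-mono-⊆ xs! xs⊆ys-x)) (filter-notAll ≢x? ys x∈ys)
      where
      ≢x? = λ y → ¬? (y ≟ x)
      x∈ys = Any.map (λ x≡y y≡x → y≡x (sym x≡y)) (xs⊆ys (here refl))
      xs⊆ys-x : xs ⊆ filter ≢x? ys
      xs⊆ys-x z∈xs = ∈-filter⁺ ≢x? (xs⊆ys (there z∈xs)) (λ z≡x → All.lookup x∉xs z∈xs (sym z≡x))

  length≤-from-member : ∀ {xs : List A} {k} → (∀ {x} → x ∈ xs → length xs ≤ k) → length xs ≤ k
  length≤-from-member {xs = []}    _ = z≤n
  length≤-from-member {xs = x ∷ _} h = h (here refl)

  module _ (_≟_ : DecidableEquality B) where

    length≤∑-fibres : ∀ (g : A → B) xs ys → (∀ {x} → x ∈ xs → g x ∈ ys) →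
                      length xs ≤ ∑[ y ∈ ys ] count (λ x → g x ≟ y) xs
    length≤∑-fibres g xs ys g[xs]⊆ys = begin
      length xs                              ≡⟨ trans (∑-const 1 xs) (ℕ.*-identityʳ _) ⟨
      ∑[ x ∈ xs ] 1                          ≤⟨ ∑-mono-≤ xs (λ x∈xs → 1≤∑𝟙 ys (g[xs]⊆ys x∈xs)) ⟩
      ∑[ x ∈ xs ] ∑[ y ∈ ys ] 𝟙 (g x ≟ y)    ≡⟨ ∑-comm (λ x y → 𝟙 (g x ≟ y)) xs ys ⟩
      ∑[ y ∈ ys ] ∑[ x ∈ xs ] 𝟙 (g x ≟ y)    ≡⟨ ∑-cong ys (λ y → sym (count≡∑𝟙 (λ x → g x ≟ y) xs)) ⟩
      ∑[ y ∈ ys ] count (λ x → g x ≟ y) xs   ∎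
      where
      open ℕ.≤-Reasoning
      1≤∑𝟙 : ∀ {b} ys → b ∈ ys → 1 ≤ ∑[ y ∈ ys ] 𝟙 (b ≟ y)
      1≤∑𝟙 {b} (y ∷ ys) (here b≡y) with b ≟ y
      ... | yes _   = s≤s z≤n
      ... | no b≢y  = ⊥-elim (b≢y b≡y)
      1≤∑𝟙 (y ∷ ys) (there b∈ys) = ℕ.≤-trans (1≤∑𝟙 ys b∈ys) (ℕ.m≤n+m _ _)

  unique-⊆-⊇⇒↭ : {xs ys : List A} → Unique xs → Unique ys → xs ⊆ ys → ys ⊆ xs → xs ↭ ys
  unique-⊆-⊇⇒↭ xs! ys! xs⊆ys ys⊆xs = ∼bag⇒↭ (unique∧set⇒bag xs! ys! (mk⇔ xs⊆ys ys⊆xs))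

  map-↭ : ∀ {xs : List A} (h h⁻¹ : A → A) → Unique xs →
          (∀ x → h⁻¹ (h x) ≡ x) → (∀ x → h (h⁻¹ x) ≡ x) →
          (∀ {x} → x ∈ xs → h x ∈ xs) → (∀ {x} → x ∈ xs → h⁻¹ x ∈ xs) → map h xs ↭ xs
  map-↭ {xs = xs} h h⁻¹ xs! left right h[xs]⊆xs h⁻¹[xs]⊆xs =
    unique-⊆-⊇⇒↭ (Unique.map⁺ injective xs!) xs! image⊆ ⊆image
    where
    injective : ∀ {x y} → h x ≡ h y → x ≡ y
    injective {x} {y} hx≡hy = trans (sym (left x)) (trans (cong h⁻¹ hx≡hy) (left y))
    image⊆ : map h xs ⊆ xs
    image⊆ y∈ with ∈-map⁻ h y∈
    ... | x , x∈xs , refl = h[xs]⊆xs x∈xs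
    ⊆image : xs ⊆ map h xs
    ⊆image {y} y∈xs = subst (_∈ map h xs) (right y) (∈-map⁺ h (h⁻¹[xs]⊆xs y∈xs))

module Arithmetic where
  open import Data.Nat using (_+_; _*_)
  open import Data.Nat.DivMod using (m*n/n≡m)
  open import Data.Integer as ℤ using (+_; _-_; +≤+)
  import Data.Integer.Properties as ℤ
  import Data.Nat.Tactic.RingSolver as ℕ-Ring

  m*2≡m+m : ∀ m → m * 2 ≡ m + m
  m*2≡m+m m = trans (ℕ.*-comm m 2) (cong (_+_ m) (ℕ.+-identityʳ m))

  half-double : ∀ m → (m + m) / 2 ≡ m
  half-double m = trans (cong (_/ 2) (sym (m*2≡m+m m))) (m*n/n≡m m 2)

  +m-+n≡+[m∸n] : ∀ {a b} → b ≤ a → + a - + b ≡ + (a ∸ b)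
  +m-+n≡+[m∸n] {a} {b} b≤a = trans (ℤ.m-n≡m⊖n a b) (ℤ.⊖-≥ b≤a)

  +d≤+b-+a-+k : ∀ {d a a′ b} k → a ≡ a′ → d + (a + k) ≤ b → + d ℤ.≤ + b - + a′ - + k
  +d≤+b-+a-+k {d} {a} {_} {b} k refl d+a+k≤b = begin
    + d                ≤⟨ +≤+ (subst (d ≤_) (sym (ℕ.∸-+-assoc b a k)) (ℕ.m+n≤o⇒m≤o∸n d d+a+k≤b)) ⟩
    + (b ∸ a ∸ k)      ≡⟨ +m-+n≡+[m∸n] k≤b∸a ⟨
    + (b ∸ a) - + k    ≡⟨ cong (_- + k) (+m-+n≡+[m∸n] a≤b) ⟨
    + b - + a - + k    ∎
    where
    open ℤ.≤-Reasoning
    a+k≤b = ℕ.m+n≤o⇒n≤o d d+a+k≤b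
    a≤b   = ℕ.m+n≤o⇒m≤o a a+k≤b
    k≤b∸a = ℕ.m+n≤o⇒m≤o∸n k (subst (_≤ b) (ℕ.+-comm a k) a+k≤b)

  twice-difference : ∀ {d N B} → d + N ≡ B → + 2 ℤ.* (+ B - + d) ≡ + (2 * N)
  twice-difference {d} {N} refl = begin
    + 2 ℤ.* (+ (d + N) - + d)  ≡⟨ cong (+ 2 ℤ.*_) (+m-+n≡+[m∸n] (ℕ.m≤m+n d N)) ⟩
    + 2 ℤ.* + (d + N ∸ d)      ≡⟨ cong (λ t → + 2 ℤ.* + t) (ℕ.m+n∸m≡n d N) ⟩
    + 2 ℤ.* + N                ≡⟨ ℤ.pos-* 2 N ⟨
    + (2 * N)                  ∎
    where open ≡-Reasoning

  -- LowerBound n (2k+1) d says 2·(2^n − d) − (2k+1) ≤ √2·2^(n/2+1); writing N = 2^n − d,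
  -- the left side is 2(N − k) − 1, whose square is 4(N − k)(N − k − 1) + 1.
  LowerBound-few : ∀ {n k d N} → d + N ≡ 2 ^ n → N ≤ k → LowerBound n (2 * k + 1) d
  LowerBound-few {n} {k} {d} {N} d+N≡2^n N≤k = inj₁ (begin
    + 2 ℤ.* (+ (2 ^ n) - + d) - + (2 * k + 1)  ≡⟨ cong (_- + (2 * k + 1)) (twice-difference {d} d+N≡2^n) ⟩
    + (2 * N) - + (2 * k + 1)                  ≤⟨ ℤ.i≤j⇒i-j≤0 (+≤+ 2N≤2k+1) ⟩
    + 0                                        ∎)
    where
    open ℤ.≤-Reasoning
    2N≤2k+1 = ℕ.≤-trans (ℕ.*-monoʳ-≤ 2 N≤k) (ℕ.m≤m+n (2 * k) 1)

  odd-square-bound : ∀ {n m Y} → n ≡ m + m → suc Y * Y < 2 * 2 ^ n →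
                     (2 * Y + 1) * (2 * Y + 1) ≤ 2 * (2 ^ (n / 2) * 2) * (2 ^ (n / 2) * 2)
  odd-square-bound {n} {m} {Y} refl [Y+1]Y<2ⁿ⁺¹ = begin
    (2 * Y + 1) * (2 * Y + 1)      ≤⟨ ℕ.m≤m+n _ 3 ⟩
    (2 * Y + 1) * (2 * Y + 1) + 3  ≡⟨ square Y ⟩
    4 * suc (suc Y * Y)            ≤⟨ ℕ.*-monoʳ-≤ 4 [Y+1]Y<2ⁿ⁺¹ ⟩
    4 * (2 * 2 ^ (m + m))          ≡⟨ cong (λ P → 4 * (2 * P)) (ℕ.^-distribˡ-+-* 2 m m) ⟩
    4 * (2 * (2 ^ m * 2 ^ m))      ≡⟨ eight (2 ^ m) ⟩
    2 * (2 ^ m * 2) * (2 ^ m * 2)  ≡⟨ cong (λ h → 2 * (2 ^ h * 2) * (2 ^ h * 2)) (half-double m) ⟨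
    2 * (2 ^ ((m + m) / 2) * 2) * (2 ^ ((m + m) / 2) * 2) ∎
    where
    open ℕ.≤-Reasoning
    square : ∀ Y → (2 * Y + 1) * (2 * Y + 1) + 3 ≡ 4 * suc (suc Y * Y)
    square = ℕ-Ring.solve-∀
    eight : ∀ P → 4 * (2 * (P * P)) ≡ 2 * (P * 2) * (P * 2)
    eight = ℕ-Ring.solve-∀

  LowerBound-many : ∀ {n m k d Y} → n ≡ m + m → d + suc (k + Y) ≡ 2 ^ n →
                    suc Y * Y < 2 * 2 ^ n → LowerBound n (2 * k + 1) d
  LowerBound-many {n} {m} {k} {d} {Y} n≡m+m d+N≡2^n [Y+1]Y<2ⁿ⁺¹ = inj₂ (begin
    t ℤ.* t                          ≡⟨ cong (λ s → s ℤ.* s) t≡2Y+1 ⟩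
    + (2 * Y + 1) ℤ.* + (2 * Y + 1)  ≡⟨ ℤ.pos-* (2 * Y + 1) (2 * Y + 1) ⟨
    + ((2 * Y + 1) * (2 * Y + 1))    ≤⟨ +≤+ (odd-square-bound {m = m} {Y} n≡m+m [Y+1]Y<2ⁿ⁺¹) ⟩
    + (2 * (2 ^ (n / 2) * 2) * (2 ^ (n / 2) * 2)) ∎)
    where
    open ℤ.≤-Reasoning
    t = + 2 ℤ.* (+ (2 ^ n) - + d) - + (2 * k + 1)
    split : ∀ k Y → 2 * suc (k + Y) ≡ (2 * k + 1) + (2 * Y + 1)
    split = ℕ-Ring.solve-∀
    t≡2Y+1 : t ≡ + (2 * Y + 1)
    t≡2Y+1 = trans (cong (_- + (2 * k + 1)) (twice-difference {d} d+N≡2^n))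
               (trans (+m-+n≡+[m∸n] (subst (2 * k + 1 ≤_) (sym (split k Y)) (ℕ.m≤m+n _ _)))
                      (cong +_ (trans (cong (_∸ (2 * k + 1)) (split k Y)) (ℕ.m+n∸m≡n (2 * k + 1) _))))

  LowerBound-of-pairs : ∀ {n m k d N M} → n ≡ m + m → suc M ≡ 2 ^ n → d + N ≡ 2 ^ n →
                        (N ∸ k) * (N ∸ suc k) ≤ M * 2 → LowerBound n (2 * k + 1) d
  LowerBound-of-pairs {n} {m} {k} {d} {N} {M} n≡m+m M+1≡2^n d+N≡2^n pairs≤ with N ℕ.≤? k
  ... | yes N≤k = LowerBound-few {n} {k} {d} {N} d+N≡2^n N≤k
  ... | no N≰k  with ℕ.m≤n⇒∃[o]m+o≡n (ℕ.≰⇒> N≰k)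
  ...   | Y , refl = LowerBound-many {n} {m} {k} {d} {Y} n≡m+m d+N≡2^n (begin-strict
    suc Y * Y                          ≡⟨ cong₂ _*_ N∸k≡Y+1 N∸k+1≡Y ⟨
    (N ∸ k) * (N ∸ suc k)              ≤⟨ pairs≤ ⟩
    M * 2                              <⟨ ℕ.*-monoˡ-< 2 (ℕ.n<1+n M) ⟩
    suc M * 2                          ≡⟨ trans (cong (_* 2) M+1≡2^n) (ℕ.*-comm (2 ^ n) 2) ⟩
    2 * 2 ^ n                          ∎)
    where
    open ℕ.≤-Reasoning
    N∸k≡Y+1 : suc (k + Y) ∸ k ≡ suc Y
    N∸k≡Y+1 = trans (ℕ.+-∸-assoc 1 (ℕ.m≤m+n k Y)) (cong suc (ℕ.m+n∸m≡n k Y))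
    N∸k+1≡Y : suc (k + Y) ∸ suc k ≡ Y
    N∸k+1≡Y = ℕ.m+n∸m≡n k Y

  pairs-bound-APN : ∀ {N M} → N * N ≤ N + M * 2 → N * (N ∸ 1) ≤ M * 2
  pairs-bound-APN {N} {M} N²≤ = begin
    N * (N ∸ 1)        ≡⟨ ℕ.*-distribˡ-∸ N N 1 ⟩
    N * N ∸ N * 1      ≡⟨ cong (N * N ∸_) (ℕ.*-identityʳ N) ⟩
    N * N ∸ N          ≤⟨ ℕ.∸-monoˡ-≤ N N²≤ ⟩
    N + M * 2 ∸ N      ≡⟨ ℕ.m+n∸m≡n N (M * 2) ⟩
    M * 2              ∎
    where open ℕ.≤-Reasoning

  pairs-bound-inverse : ∀ {N M C} → N * N ≤ N + (M * 2 + 2 * C) → C < N → (N ∸ 1) * (N ∸ 2) ≤ M * 2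
  pairs-bound-inverse {suc zero}    _ _ = z≤n
  pairs-bound-inverse {suc (suc Y)} {M} {C} N²≤ (s≤s C≤Y+1) = ℕ.+-cancelʳ-≤ (3 * Y + 4) _ _ (begin
    suc Y * Y + (3 * Y + 4)                    ≡⟨ expand-left Y ⟩
    (2 + Y) * (2 + Y)                          ≤⟨ N²≤ ⟩
    (2 + Y) + (M * 2 + 2 * C)                  ≤⟨ ℕ.+-monoʳ-≤ (2 + Y) (ℕ.+-monoʳ-≤ (M * 2) (ℕ.*-monoʳ-≤ 2 C≤Y+1)) ⟩
    (2 + Y) + (M * 2 + 2 * suc Y)              ≡⟨ expand-right Y M ⟩
    M * 2 + (3 * Y + 4)                        ∎)
    where
    open ℕ.≤-Reasoning
    expand-left : ∀ Y → suc Y * Y + (3 * Y + 4) ≡ (2 + Y) * (2 + Y)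
    expand-left = ℕ-Ring.solve-∀
    expand-right : ∀ Y M → (2 + Y) + (M * 2 + 2 * suc Y) ≡ M * 2 + (3 * Y + 4)
    expand-right = ℕ-Ring.solve-∀

  [s+1]*4≡[2s+2]+[2s+2] : ∀ s → suc s * 4 ≡ suc (2 * s + 1) + suc (2 * s + 1)
  [s+1]*4≡[2s+2]+[2s+2] = ℕ-Ring.solve-∀

  [2ᵏ+1]*2≡2ᵏ⁺¹+1+1 : ∀ k → (2 ^ k + 1) * 2 ≡ suc (2 ^ suc k) + 1
  [2ᵏ+1]*2≡2ᵏ⁺¹+1+1 k = expand (2 ^ k)
    where
    expand : ∀ X → (X + 1) * 2 ≡ suc (2 * X) + 1
    expand = ℕ-Ring.solve-∀

  [q+1][q-1]≡q²-1 : ∀ q → suc q * (q ∸ 1) ≡ q * q ∸ 1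
  [q+1][q-1]≡q²-1 zero    = refl
  [q+1][q-1]≡q²-1 (suc p) = expand p
    where
    expand : ∀ p → suc (suc p) * p ≡ p + p * suc p
    expand = ℕ-Ring.solve-∀

  q²-1≤[q-1]u⇒q<u : ∀ {q u} → 2 ≤ q → q * q ∸ 1 ≤ (q ∸ 1) * u → suc q ≤ u
  q²-1≤[q-1]u⇒q<u {suc zero}    (s≤s ())
  q²-1≤[q-1]u⇒q<u {suc (suc p)} {u} _ q²-1≤[q-1]u with suc (suc (suc p)) ℕ.≤? u
  ... | yes q<u = q<u
  ... | no q≮u  = ⊥-elim (ℕ.n≮n X (begin-strict
    X          <⟨ ℕ.m<n+m X (s≤s z≤n) ⟩
    suc p + X  ≤⟨ q²-1≤[q-1]u ⟩
    suc p * u  ≤⟨ ℕ.*-monoʳ-≤ (suc p) (ℕ.≤-pred (ℕ.≰⇒> q≮u)) ⟩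
    X          ∎))
    where
    open ℕ.≤-Reasoning
    X = suc p * suc (suc p)

module GaloisField {n : ℕ} (F : BinaryField n) where
  open BinaryField F
  open IsCommutativeRing isCommutativeRing
    using ( +-assoc; +-comm; +-identityˡ; +-identityʳ; -‿inverseˡ; -‿inverseʳ
          ; *-assoc; *-comm; *-identityˡ; *-identityʳ; distribʳ; zeroˡ; zeroʳ
          ; +-isCommutativeMonoid; *-isCommutativeMonoid )
  open Counting
  open Arithmetic
    using ( LowerBound-of-pairs; pairs-bound-APN; pairs-bound-inverse
          ; [q+1][q-1]≡q²-1; q²-1≤[q-1]u⇒q<u; [2ᵏ+1]*2≡2ᵏ⁺¹+1+1 )

  commutativeRing : CommutativeRing 0ℓ 0ℓ
  commutativeRing = record { isCommutativeRing = isCommutativeRing }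

  open CommutativeRing commutativeRing using (commutativeSemiring; semiring)
  open import Algebra.Solver.Ring.NaturalCoefficients.Default commutativeSemiring
    using (solve; _:=_; _:+_; _:*_)
  open import Algebra.Properties.Semiring.Mult semiring using (_×_; ×1-homo-*)
  open import Data.List.Relation.Binary.Permutation.Setoid.Properties (setoid Carrier)
    using (foldr-commMonoid)
  open import Data.List.Relation.Binary.Permutation.Propositional using (↭⇒↭ₛ)

  1≢0 : 1# ≢ 0#
  1≢0 = 0≢1 ∘ sym

  +-cancelˡ : ∀ x {y z} → x + y ≡ x + z → y ≡ z
  +-cancelˡ x {y} {z} x+y≡x+z = begin
    y                ≡⟨ +-identityˡ y ⟨
    0# + y           ≡⟨ cong (_+ y) (-‿inverseˡ x) ⟨
    (- x + x) + y    ≡⟨ +-assoc (- x) x y ⟩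
    - x + (x + y)    ≡⟨ cong (- x +_) x+y≡x+z ⟩
    - x + (x + z)    ≡⟨ +-assoc (- x) x z ⟨
    (- x + x) + z    ≡⟨ cong (_+ z) (-‿inverseˡ x) ⟩
    0# + z           ≡⟨ +-identityˡ z ⟩
    z                ∎
    where open ≡-Reasoning

  *-cancelˡ : ∀ {x y z} → x ≢ 0# → x * y ≡ x * z → y ≡ z
  *-cancelˡ {x} {y} {z} x≢0 xy≡xz = begin
    y                ≡⟨ *-identityˡ y ⟨
    1# * y           ≡⟨ cong (_* y) x⁻¹x≡1 ⟨
    (x⁻¹ * x) * y    ≡⟨ *-assoc x⁻¹ x y ⟩
    x⁻¹ * (x * y)    ≡⟨ cong (x⁻¹ *_) xy≡xz ⟩
    x⁻¹ * (x * z)    ≡⟨ *-assoc x⁻¹ x z ⟨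
    (x⁻¹ * x) * z    ≡⟨ cong (_* z) x⁻¹x≡1 ⟩
    1# * z           ≡⟨ *-identityˡ z ⟩
    z                ∎
    where
    open ≡-Reasoning
    x⁻¹ = proj₁ (inverse x x≢0)
    x⁻¹x≡1 = trans (*-comm x⁻¹ x) (proj₂ (inverse x x≢0))

  *-cancelʳ : ∀ {x y z} → z ≢ 0# → x * z ≡ y * z → x ≡ y
  *-cancelʳ {x} {y} {z} z≢0 xz≡yz = *-cancelˡ z≢0 (trans (*-comm z x) (trans xz≡yz (*-comm y z)))

  *-nonzero : ∀ {x y} → x ≢ 0# → y ≢ 0# → x * y ≢ 0#
  *-nonzero {x} x≢0 y≢0 xy≡0 = y≢0 (*-cancelˡ x≢0 (trans xy≡0 (sym (zeroʳ x))))

  zero-product : ∀ x y → x * y ≡ 0# → x ≡ 0# ⊎ y ≡ 0#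
  zero-product x y xy≡0 with x ≟ 0# | y ≟ 0#
  ... | yes x≡0 | _       = inj₁ x≡0
  ... | no _    | yes y≡0 = inj₂ y≡0
  ... | no x≢0  | no y≢0  = ⊥-elim (*-nonzero x≢0 y≢0 xy≡0)

  pow-+ : ∀ x a b → pow x (a ℕ.+ b) ≡ pow x a * pow x b
  pow-+ x zero    b = sym (*-identityˡ _)
  pow-+ x (suc a) b = trans (cong (x *_) (pow-+ x a b)) (sym (*-assoc x _ _))

  pow-* : ∀ x a b → pow x (a ℕ.* b) ≡ pow (pow x a) b
  pow-* x a zero    = cong (pow x) (ℕ.*-zeroʳ a)
  pow-* x a (suc b) = begin
    pow x (a ℕ.* suc b)        ≡⟨ cong (pow x) (ℕ.*-suc a b) ⟩
    pow x (a ℕ.+ a ℕ.* b)      ≡⟨ pow-+ x a (a ℕ.* b) ⟩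
    pow x a * pow x (a ℕ.* b)  ≡⟨ cong (pow x a *_) (pow-* x a b) ⟩
    pow (pow x a) (suc b)      ∎
    where open ≡-Reasoning

  pow-distrib-* : ∀ x y k → pow (x * y) k ≡ pow x k * pow y k
  pow-distrib-* x y zero    = sym (*-identityˡ 1#)
  pow-distrib-* x y (suc k) = trans (cong ((x * y) *_) (pow-distrib-* x y k))
    (solve 4 (λ x y a b → (x :* y) :* (a :* b) := (x :* a) :* (y :* b)) refl x y _ _)

  pow-1# : ∀ k → pow 1# k ≡ 1#
  pow-1# zero    = refl
  pow-1# (suc k) = trans (*-identityˡ _) (pow-1# k)

  pow-0# : ∀ {k} → k > 0 → pow 0# k ≡ 0#
  pow-0# {suc k} _ = zeroˡ _

  pow-nonzero : ∀ {x} k → x ≢ 0# → pow x k ≢ 0#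
  pow-nonzero zero    x≢0 = 1≢0
  pow-nonzero (suc k) x≢0 = *-nonzero x≢0 (pow-nonzero k x≢0)

  pow-two : ∀ x → pow x 2 ≡ x * x
  pow-two x = cong (x *_) (*-identityʳ x)

  -- Characteristic 2 and Fermat's little theorem

  Σ : List Carrier → Carrier
  Σ = foldr _+_ 0#

  Π : List Carrier → Carrier
  Π = foldr _*_ 1#

  Σ-↭ : ∀ {xs ys} → xs ↭ ys → Σ xs ≡ Σ ys
  Σ-↭ = foldr-commMonoid +-isCommutativeMonoid ∘ ↭⇒↭ₛ

  Π-↭ : ∀ {xs ys} → xs ↭ ys → Π xs ≡ Π ys
  Π-↭ = foldr-commMonoid *-isCommutativeMonoid ∘ ↭⇒↭ₛ

  translate-↭ : ∀ y → map (y +_) elements ↭ elements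
  translate-↭ y = map-↭ (y +_) (- y +_) unique left right (λ _ → complete _) (λ _ → complete _)
    where
    left : ∀ x → - y + (y + x) ≡ x
    left x = trans (sym (+-assoc (- y) y x)) (trans (cong (_+ x) (-‿inverseˡ y)) (+-identityˡ x))
    right : ∀ x → y + (- y + x) ≡ x
    right x = trans (sym (+-assoc y (- y) x)) (trans (cong (_+ x) (-‿inverseʳ y)) (+-identityˡ x))

  Σ-translate : ∀ y xs → Σ (map (y +_) xs) ≡ length xs × y + Σ xs
  Σ-translate y []       = sym (+-identityˡ 0#)
  Σ-translate y (x ∷ xs) = trans (cong ((y + x) +_) (Σ-translate y xs))
    (solve 4 (λ y x t s → (y :+ x) :+ (t :+ s) := (y :+ t) :+ (x :+ s)) refl y x _ _)

  2^k×1≡[1+1]^k : ∀ k → (2 ^ k) × 1# ≡ pow (1# + 1#) k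
  2^k×1≡[1+1]^k zero    = +-identityʳ 1#
  2^k×1≡[1+1]^k (suc k) = begin
    (2 ℕ.* 2 ^ k) × 1#           ≡⟨ ×1-homo-* 2 (2 ^ k) ⟩
    (2 × 1#) * ((2 ^ k) × 1#)    ≡⟨ cong₂ _*_ (cong (1# +_) (+-identityʳ 1#)) (2^k×1≡[1+1]^k k) ⟩
    (1# + 1#) * pow (1# + 1#) k  ∎
    where open ≡-Reasoning

  -- Translation by 1 permutes the field, so the sum of all elements is unchanged while
  -- it gains |F|·1 = 2^n·1 = (1+1)^n.
  1+1≡0 : 1# + 1# ≡ 0#
  1+1≡0 with (1# + 1#) ≟ 0#
  ... | yes 1+1≡0 = 1+1≡0
  ... | no 1+1≢0  = ⊥-elim (pow-nonzero n 1+1≢0 (trans (sym (2^k×1≡[1+1]^k n)) 2^n×1≡0))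
    where
    2^n×1≡0 : (2 ^ n) × 1# ≡ 0#
    2^n×1≡0 = +-cancelʳ′ (begin
      (2 ^ n) × 1# + Σ elements             ≡⟨ cong (λ k → k × 1# + Σ elements) size ⟨
      length elements × 1# + Σ elements     ≡⟨ Σ-translate 1# elements ⟨
      Σ (map (1# +_) elements)              ≡⟨ Σ-↭ (translate-↭ 1#) ⟩
      Σ elements                            ≡⟨ +-identityˡ _ ⟨
      0# + Σ elements                       ∎)
      where
      open ≡-Reasoning
      +-cancelʳ′ : ∀ {a b} → a + Σ elements ≡ b + Σ elements → a ≡ b
      +-cancelʳ′ {a} {b} e = +-cancelˡ (Σ elements) (trans (+-comm _ a) (trans e (+-comm b _)))

  x+x≡0 : ∀ x → x + x ≡ 0#
  x+x≡0 x = begin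
    x + x              ≡⟨ cong₂ _+_ (*-identityˡ x) (*-identityˡ x) ⟨
    1# * x + 1# * x    ≡⟨ distribʳ x 1# 1# ⟨
    (1# + 1#) * x      ≡⟨ cong (_* x) 1+1≡0 ⟩
    0# * x             ≡⟨ zeroˡ x ⟩
    0#                 ∎
    where open ≡-Reasoning

  x+[x+y]≡y : ∀ x y → x + (x + y) ≡ y
  x+[x+y]≡y x y = trans (sym (+-assoc x x y)) (trans (cong (_+ y) (x+x≡0 x)) (+-identityˡ y))

  +≡0⇒≡ : ∀ {x y} → x + y ≡ 0# → x ≡ y
  +≡0⇒≡ {x} {y} x+y≡0 = trans (sym (x+[x+y]≡y y x)) (trans (cong (y +_) (trans (+-comm y x) x+y≡0)) (+-identityʳ y))

  square-+ : ∀ x y → (x + y) * (x + y) ≡ x * x + y * y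
  square-+ x y = begin
    (x + y) * (x + y)                      ≡⟨ solve 2 (λ x y → (x :+ y) :* (x :+ y) := (x :* x :+ y :* y) :+ (x :* y :+ x :* y)) refl x y ⟩
    (x * x + y * y) + (x * y + x * y)      ≡⟨ cong ((x * x + y * y) +_) (x+x≡0 (x * y)) ⟩
    (x * x + y * y) + 0#                   ≡⟨ +-identityʳ _ ⟩
    x * x + y * y                          ∎
    where open ≡-Reasoning

  frobenius-isLinear : ∀ j → IsLinear (λ x → pow x (2 ^ j))
  frobenius-isLinear zero    x y = trans (*-identityʳ _) (sym (cong₂ _+_ (*-identityʳ x) (*-identityʳ y)))
  frobenius-isLinear (suc j) x y = begin
    pow (x + y) (2 ℕ.* 2 ^ j)                    ≡⟨ pow-* (x + y) 2 (2 ^ j) ⟩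
    pow (pow (x + y) 2) (2 ^ j)                  ≡⟨ cong (λ z → pow z (2 ^ j)) (pow-two-+) ⟩
    pow (pow x 2 + pow y 2) (2 ^ j)              ≡⟨ frobenius-isLinear j (pow x 2) (pow y 2) ⟩
    pow (pow x 2) (2 ^ j) + pow (pow y 2) (2 ^ j) ≡⟨ cong₂ _+_ (pow-* x 2 (2 ^ j)) (pow-* y 2 (2 ^ j)) ⟨
    pow x (2 ℕ.* 2 ^ j) + pow y (2 ℕ.* 2 ^ j)    ∎
    where
    open ≡-Reasoning
    pow-two-+ : pow (x + y) 2 ≡ pow x 2 + pow y 2
    pow-two-+ = trans (pow-two (x + y)) (trans (square-+ x y) (sym (cong₂ _+_ (pow-two x) (pow-two y))))

  nonzero : List Carrier
  nonzero = filter (λ x → ¬? (x ≟ 0#)) elements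

  ∈-nonzero⁺ : ∀ {x} → x ≢ 0# → x ∈ nonzero
  ∈-nonzero⁺ {x} = ∈-filter⁺ (λ x → ¬? (x ≟ 0#)) (complete x)

  ∈-nonzero⁻ : ∀ {x} → x ∈ nonzero → x ≢ 0#
  ∈-nonzero⁻ = proj₂ ∘ ∈-filter⁻ (λ x → ¬? (x ≟ 0#)) {xs = elements}

  nonzero-unique : Unique nonzero
  nonzero-unique = Unique.filter⁺ (λ x → ¬? (x ≟ 0#)) unique

  elements↭0∷nonzero : elements ↭ 0# ∷ nonzero
  elements↭0∷nonzero = unique-⊆-⊇⇒↭ unique (All.tabulate (λ x∈ 0≡x → ∈-nonzero⁻ x∈ (sym 0≡x)) ∷ nonzero-unique)
    (λ {x} _ → case0 x) (λ _ → complete _)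
    where
    case0 : ∀ x → x ∈ 0# ∷ nonzero
    case0 x with x ≟ 0#
    ... | yes x≡0 = here x≡0
    ... | no x≢0  = there (∈-nonzero⁺ x≢0)

  |nonzero|+1≡2^n : suc (length nonzero) ≡ 2 ^ n
  |nonzero|+1≡2^n = trans (sym (↭.↭-length elements↭0∷nonzero)) size

  Π-scale : ∀ y xs → Π (map (y *_) xs) ≡ pow y (length xs) * Π xs
  Π-scale y []       = sym (*-identityˡ 1#)
  Π-scale y (x ∷ xs) = trans (cong ((y * x) *_) (Π-scale y xs))
    (solve 4 (λ y x p q → (y :* x) :* (p :* q) := (y :* p) :* (x :* q)) refl y x _ _)

  scale-↭ : ∀ {y} → y ≢ 0# → map (y *_) nonzero ↭ nonzero
  scale-↭ {y} y≢0 = map-↭ (y *_) (y⁻¹ *_) nonzero-unique left right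
    (λ x∈ → ∈-nonzero⁺ (*-nonzero y≢0 (∈-nonzero⁻ x∈))) (λ x∈ → ∈-nonzero⁺ (*-nonzero y⁻¹≢0 (∈-nonzero⁻ x∈)))
    where
    y⁻¹ = proj₁ (inverse y y≢0)
    yy⁻¹≡1 = proj₂ (inverse y y≢0)
    y⁻¹≢0 : y⁻¹ ≢ 0#
    y⁻¹≢0 y⁻¹≡0 = 1≢0 (trans (sym yy⁻¹≡1) (trans (cong (y *_) y⁻¹≡0) (zeroʳ y)))
    left : ∀ x → y⁻¹ * (y * x) ≡ x
    left x = trans (sym (*-assoc y⁻¹ y x)) (trans (cong (_* x) (trans (*-comm y⁻¹ y) yy⁻¹≡1)) (*-identityˡ x))
    right : ∀ x → y * (y⁻¹ * x) ≡ x
    right x = trans (sym (*-assoc y y⁻¹ x)) (trans (cong (_* x) yy⁻¹≡1) (*-identityˡ x))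

  Π-nonzero : ∀ xs → (∀ {x} → x ∈ xs → x ≢ 0#) → Π xs ≢ 0#
  Π-nonzero []       _     = 1≢0
  Π-nonzero (x ∷ xs) xs≢0 = *-nonzero (xs≢0 (here refl)) (Π-nonzero xs (xs≢0 ∘ there))

  fermat : ∀ {y} → y ≢ 0# → pow y (2 ^ n ∸ 1) ≡ 1#
  fermat {y} y≢0 = *-cancelˡ (Π-nonzero nonzero ∈-nonzero⁻) (begin
    Π nonzero * pow y (2 ^ n ∸ 1)            ≡⟨ cong (λ k → Π nonzero * pow y (k ∸ 1)) |nonzero|+1≡2^n ⟨
    Π nonzero * pow y (length nonzero)       ≡⟨ *-comm _ _ ⟩
    pow y (length nonzero) * Π nonzero       ≡⟨ Π-scale y nonzero ⟨
    Π (map (y *_) nonzero)                   ≡⟨ Π-↭ (scale-↭ y≢0) ⟩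
    Π nonzero                                ≡⟨ *-identityʳ _ ⟨
    Π nonzero * 1#                           ∎)
    where open ≡-Reasoning

  pow-2^n : ∀ x → pow x (2 ^ n) ≡ x
  pow-2^n x with x ≟ 0#
  ... | yes refl = trans (cong (pow 0#) (sym |nonzero|+1≡2^n)) (pow-0# {suc (length nonzero)} (s≤s z≤n))
  ... | no x≢0   = begin
    pow x (2 ^ n)                 ≡⟨ cong (pow x) (sym |nonzero|+1≡2^n) ⟩
    x * pow x (length nonzero)    ≡⟨ cong (λ k → x * pow x (k ∸ 1)) |nonzero|+1≡2^n ⟩
    x * pow x (2 ^ n ∸ 1)         ≡⟨ cong (x *_) (fermat x≢0) ⟩
    x * 1#                        ≡⟨ *-identityʳ x ⟩
    x                             ∎
    where open ≡-Reasoning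

  -- Roots of polynomials

  -- horner u (c₁ ∷ … ∷ cₖ) x = u xᵏ + c₁ xᵏ⁻¹ + … + cₖ
  horner : Carrier → List Carrier → Carrier → Carrier
  horner u []       x = u
  horner u (c ∷ cs) x = horner (u * x + c) cs x

  synthetic-quotient : Carrier → Carrier → List Carrier → List Carrier
  synthetic-quotient r v []       = []
  synthetic-quotient r v (c ∷ cs) = v ∷ synthetic-quotient r (v * r + c) cs

  length-synthetic-quotient : ∀ r v cs → length (synthetic-quotient r v cs) ≡ length cs
  length-synthetic-quotient r v []       = refl
  length-synthetic-quotient r v (c ∷ cs) = cong suc (length-synthetic-quotient r (v * r + c) cs)

  -- Synthetic division by x + r, which is x − r since the characteristic is 2.
  horner-divide : ∀ r x u v w cs → u ≡ (x + r) * w + v →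
                  horner u cs x ≡ (x + r) * horner w (synthetic-quotient r v cs) x + horner v cs r
  horner-divide r x u v w []       u≡ = u≡
  horner-divide r x u v w (c ∷ cs) u≡ = horner-divide r x (u * x + c) (v * r + c) (w * x + v) cs (begin
    u * x + c                                          ≡⟨ cong (λ t → t * x + c) u≡ ⟩
    ((x + r) * w + v) * x + c                          ≡⟨ +-identityʳ _ ⟨
    (((x + r) * w + v) * x + c) + 0#                   ≡⟨ cong (_ +_) (x+x≡0 (r * v)) ⟨
    (((x + r) * w + v) * x + c) + (r * v + r * v)      ≡⟨ solve 5 (λ x r w v c → (((x :+ r) :* w :+ v) :* x :+ c) :+ (r :* v :+ r :* v)
                                                                := (x :+ r) :* (w :* x :+ v) :+ (v :* r :+ c)) refl x r w v c ⟩
    (x + r) * (w * x + v) + (v * r + c)                ∎)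
    where open ≡-Reasoning

  monic-roots-bound : ∀ cs rs → Unique rs → (∀ {r} → r ∈ rs → horner 1# cs r ≡ 0#) → length rs ≤ length cs
  monic-roots-bound cs       []       _            _      = z≤n
  monic-roots-bound []       (r ∷ rs) _            roots  = ⊥-elim (1≢0 (roots (here refl)))
  monic-roots-bound (c ∷ cs) (r ∷ rs) (r∉rs ∷ rs!) roots =
    s≤s (ℕ.≤-trans (monic-roots-bound qs rs rs! quotient-roots) (ℕ.≤-reflexive (length-synthetic-quotient r _ cs)))
    where
    qs = synthetic-quotient r (1# * r + c) cs
    factor : ∀ x → horner 1# (c ∷ cs) x ≡ (x + r) * horner 1# qs x
    factor x = begin
      horner 1# (c ∷ cs) x
        ≡⟨ horner-divide r x 1# 1# 0# (c ∷ cs) (sym (trans (cong (_+ 1#) (zeroʳ (x + r))) (+-identityˡ 1#))) ⟩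
      (x + r) * horner (0# * x + 1#) qs x + horner 1# (c ∷ cs) r
        ≡⟨ cong₂ (λ u t → (x + r) * horner u qs x + t) 0x+1≡1 (roots (here refl)) ⟩
      (x + r) * horner 1# qs x + 0#
        ≡⟨ +-identityʳ _ ⟩
      (x + r) * horner 1# qs x
        ∎
      where
      open ≡-Reasoning
      0x+1≡1 = trans (cong (_+ 1#) (zeroˡ x)) (+-identityˡ 1#)
    quotient-roots : ∀ {s} → s ∈ rs → horner 1# qs s ≡ 0#
    quotient-roots {s} s∈rs with zero-product (s + r) _ (trans (sym (factor s)) (roots (there s∈rs)))
    ... | inj₁ s+r≡0 = ⊥-elim (All.lookup r∉rs s∈rs (sym (+≡0⇒≡ s+r≡0)))
    ... | inj₂ q[s]≡0 = q[s]≡0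

  roots-of-unity-bound : ∀ e rs → Unique rs → (∀ {r} → r ∈ rs → pow r (suc e) ≡ 1#) → length rs ≤ suc e
  roots-of-unity-bound e rs rs! roots =
    ℕ.≤-trans (monic-roots-bound cs rs rs! (λ r∈rs → trans (horner-xᵉ⁺¹+1 _) (≡1⇒+1≡0 (roots r∈rs))))
              (ℕ.≤-reflexive length-cs)
    where
    cs = replicate e 0# ++ 1# ∷ []
    length-cs : length cs ≡ suc e
    length-cs = trans (length-++ (replicate e 0#)) (trans (cong (ℕ._+ 1) (length-replicate e)) (ℕ.+-comm e 1))
    horner-replicate : ∀ u k x → horner u (replicate k 0#) x ≡ u * pow x k
    horner-replicate u zero    x = sym (*-identityʳ u)
    horner-replicate u (suc k) x = trans (horner-replicate (u * x + 0#) k x) (trans (cong (_* pow x k) (+-identityʳ _)) (*-assoc u x _))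
    horner-xᵉ⁺¹+1 : ∀ x → horner 1# cs x ≡ pow x (suc e) + 1#
    horner-xᵉ⁺¹+1 x = begin
      horner 1# cs x                                   ≡⟨ horner-++ 1# (replicate e 0#) x ⟩
      horner 1# (replicate e 0#) x * x + 1#            ≡⟨ cong (λ t → t * x + 1#) (trans (horner-replicate 1# e x) (*-identityˡ _)) ⟩
      pow x e * x + 1#                                 ≡⟨ cong (_+ 1#) (*-comm _ x) ⟩
      pow x (suc e) + 1#                               ∎
      where
      open ≡-Reasoning
      horner-++ : ∀ u ds x → horner u (ds ++ 1# ∷ []) x ≡ horner u ds x * x + 1#
      horner-++ u []       x = refl
      horner-++ u (d ∷ ds) x = horner-++ (u * x + d) ds x
    ≡1⇒+1≡0 : ∀ {a} → a ≡ 1# → a + 1# ≡ 0#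
    ≡1⇒+1≡0 refl = 1+1≡0

  -- Agreement with affine maps

  agreements : (Carrier → Carrier) → (Carrier → Carrier) → ℕ
  agreements f g = count (λ x → f x ≟ g x) elements

  dH+agreements≡2^n : ∀ f g → dH f g ℕ.+ agreements f g ≡ 2 ^ n
  dH+agreements≡2^n f g = trans (ℕ.+-comm (dH f g) _) (trans (count+count-∁ (λ x → f x ≟ g x) elements) size)

  count-translate : ∀ {P : Pred Carrier 0ℓ} (P? : Decidable P) y →
                    count (λ a → P? (y + a)) elements ≡ count P? elements
  count-translate P? y = trans (sym (count-map P? (y +_) elements)) (count-↭ P? (translate-↭ y))

  -- Counting ordered pairs (x, x + a) of points of P, grouped by their difference a.
  count-pairs : ∀ {P : Pred Carrier 0ℓ} (P? : Decidable P) → let N = count P? elements in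
                N ℕ.* N ≡ N ℕ.+ ∑[ a ∈ nonzero ] count (λ x → P? x ×-dec P? (x + a)) elements
  count-pairs {P} P? = begin
    N ℕ.* N                                                 ≡⟨ ∑-const N S ⟨
    ∑[ x ∈ S ] N                                            ≡⟨ ∑-cong S (λ x → sym (count-translate P? x)) ⟩
    ∑[ x ∈ S ] count (λ a → P? (x + a)) elements            ≡⟨ ∑-cong S (λ x → count≡∑𝟙 (λ a → P? (x + a)) elements) ⟩
    ∑[ x ∈ S ] ∑[ a ∈ elements ] 𝟙 (P? (x + a))            ≡⟨ ∑-comm (λ x a → 𝟙 (P? (x + a))) S elements ⟩
    ∑[ a ∈ elements ] ∑[ x ∈ S ] 𝟙 (P? (x + a))            ≡⟨ ∑-cong elements pairs-with-difference ⟩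
    ∑[ a ∈ elements ] pairs a                               ≡⟨ ∑-↭ pairs elements↭0∷nonzero ⟩
    pairs 0# ℕ.+ ∑[ a ∈ nonzero ] pairs a                   ≡⟨ cong (ℕ._+ ∑ nonzero pairs) pairs-at-0 ⟩
    N ℕ.+ ∑[ a ∈ nonzero ] pairs a                          ∎
    where
    open ≡-Reasoning
    S = filter P? elements
    N = length S
    pairs : Carrier → ℕ
    pairs a = count (λ x → P? x ×-dec P? (x + a)) elements
    pairs-with-difference : ∀ a → ∑[ x ∈ S ] 𝟙 (P? (x + a)) ≡ pairs a
    pairs-with-difference a = trans (sym (count≡∑𝟙 (λ x → P? (x + a)) S)) (count-filter P? (λ x → P? (x + a)) elements)
    pairs-at-0 : pairs 0# ≡ N
    pairs-at-0 = ℕ.≤-antisym (count-mono _ P? proj₁ elements)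
      (count-mono P? _ (λ {x} Px → Px , subst P (sym (+-identityʳ x)) Px) elements)

  differences : (Carrier → Carrier) → Carrier → Carrier → ℕ
  differences f a b = count (λ x → (f x + f (x + a)) ≟ b) elements

  agreements-squared : ∀ f {L} c → IsLinear L → let N = agreements f (λ x → L x + c) in
                       N ℕ.* N ≤ N ℕ.+ ∑[ a ∈ nonzero ] differences f a (L a)
  agreements-squared f {L} c L-linear = ℕ.≤-trans (ℕ.≤-reflexive (count-pairs agree?))
    (ℕ.+-monoʳ-≤ _ (∑-mono-≤ nonzero (λ {a} _ → count-mono _ _ (λ (fx≡ , fx+a≡) → difference fx≡ fx+a≡) elements)))
    where
    agree? = λ x → f x ≟ (L x + c)
    difference : ∀ {x a} → f x ≡ L x + c → f (x + a) ≡ L (x + a) + c → f x + f (x + a) ≡ L a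
    difference {x} {a} fx≡ fx+a≡ = begin
      f x + f (x + a)                      ≡⟨ cong₂ _+_ fx≡ (trans fx+a≡ (cong (_+ c) (L-linear x a))) ⟩
      (L x + c) + ((L x + L a) + c)
        ≡⟨ solve 3 (λ p q c → (p :+ c) :+ ((p :+ q) :+ c) := (p :+ p) :+ ((c :+ c) :+ q)) refl (L x) (L a) c ⟩
      (L x + L x) + ((c + c) + L a)        ≡⟨ cong₂ (λ s t → s + (t + L a)) (x+x≡0 (L x)) (x+x≡0 c) ⟩
      0# + (0# + L a)                      ≡⟨ trans (+-identityˡ _) (+-identityˡ _) ⟩
      L a                                  ∎
      where open ≡-Reasoning

  agreements⇒LowerBound : ∀ {m} k (f L : Carrier → Carrier) c → n ≡ m ℕ.+ m → let N = agreements f (λ x → L x + c) in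
                          (N ∸ k) ℕ.* (N ∸ suc k) ≤ length nonzero ℕ.* 2 →
                          LowerBound n (2 ℕ.* k ℕ.+ 1) (dH f (λ x → L x + c))
  agreements⇒LowerBound {m} k f L c n≡m+m =
    LowerBound-of-pairs {n} {m} {k} {dH f (λ x → L x + c)} {agreements f (λ x → L x + c)} {length nonzero}
      n≡m+m |nonzero|+1≡2^n (dH+agreements≡2^n f (λ x → L x + c))

  -- The unit circle

  module UnitCircle {m : ℕ} (n≡m+m : n ≡ m ℕ.+ m) (1≤m : 1 ≤ m) where

    q : ℕ
    q = 2 ^ m

    2≤q : 2 ≤ q
    2≤q = ℕ.^-monoʳ-≤ 2 1≤m

    2^n≡q*q : 2 ^ n ≡ q ℕ.* q
    2^n≡q*q = trans (cong (2 ^_) n≡m+m) (ℕ.^-distribˡ-+-* 2 m m)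

    norm : Carrier → Carrier
    norm x = pow x (suc q)

    circle : List Carrier
    circle = filter (λ u → norm u ≟ 1#) elements

    ∈-circle⁻ : ∀ {u} → u ∈ circle → norm u ≡ 1#
    ∈-circle⁻ = proj₂ ∘ ∈-filter⁻ (λ u → norm u ≟ 1#) {xs = elements}

    circle-nonzero : ∀ {u} → u ∈ circle → u ≢ 0#
    circle-nonzero u∈ refl = 1≢0 (trans (sym (∈-circle⁻ u∈)) (pow-0# {suc q} (s≤s z≤n)))

    subfield× : List Carrier
    subfield× = filter (λ y → pow y (q ∸ 1) ≟ 1#) elements

    |subfield×|≤q-1 : length subfield× ≤ q ∸ 1
    |subfield×|≤q-1 = subst (length subfield× ≤_) q-2+1≡q-1
      (roots-of-unity-bound (q ∸ 2) subfield× (Unique.filter⁺ _ unique) (λ {y} y∈ →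
        subst (λ e → pow y e ≡ 1#) (sym q-2+1≡q-1) (proj₂ (∈-filter⁻ (λ y → pow y (q ∸ 1) ≟ 1#) {xs = elements} y∈))))
      where
      q-2+1≡q-1 : suc (q ∸ 2) ≡ q ∸ 1
      q-2+1≡q-1 = trans (sym (ℕ.+-∸-assoc 1 2≤q)) refl

    norm∈subfield× : ∀ {x} → x ∈ nonzero → norm x ∈ subfield×
    norm∈subfield× {x} x∈ = ∈-filter⁺ (λ y → pow y (q ∸ 1) ≟ 1#) (complete (norm x)) (begin
      pow (pow x (suc q)) (q ∸ 1)   ≡⟨ pow-* x (suc q) (q ∸ 1) ⟨
      pow x (suc q ℕ.* (q ∸ 1))     ≡⟨ cong (pow x) (trans ([q+1][q-1]≡q²-1 q) (cong (_∸ 1) (sym 2^n≡q*q))) ⟩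
      pow x (2 ^ n ∸ 1)             ≡⟨ fermat (∈-nonzero⁻ x∈) ⟩
      1#                            ∎)
      where open ≡-Reasoning

    -- Dividing by one point x₀ of a fibre of the norm maps that fibre injectively into the circle.
    fibre≤circle : ∀ y → count (λ x → norm x ≟ y) nonzero ≤ length circle
    fibre≤circle y = length≤-from-member divide
      where
      open ≡-Reasoning
      fibre = filter (λ x → norm x ≟ y) nonzero
      divide : ∀ {x₀} → x₀ ∈ fibre → length fibre ≤ length circle
      divide {x₀} x₀∈ = subst (_≤ length circle) (length-map (_* x₀⁻¹) fibre)
        (length-mono-⊆ _≟_ (Unique.map⁺ (*-cancelʳ x₀⁻¹≢0) (Unique.filter⁺ _ nonzero-unique)) image⊆circle)
        where
        x₀∈fibre = ∈-filter⁻ (λ x → norm x ≟ y) {xs = nonzero} x₀∈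
        norm[x₀]≡y = proj₂ x₀∈fibre
        x₀≢0 = ∈-nonzero⁻ (proj₁ x₀∈fibre)
        x₀⁻¹ = proj₁ (inverse x₀ x₀≢0)
        x₀x₀⁻¹≡1 = proj₂ (inverse x₀ x₀≢0)
        x₀⁻¹≢0 : x₀⁻¹ ≢ 0#
        x₀⁻¹≢0 x₀⁻¹≡0 = 1≢0 (trans (sym x₀x₀⁻¹≡1) (trans (cong (x₀ *_) x₀⁻¹≡0) (zeroʳ x₀)))
        image⊆circle : map (_* x₀⁻¹) fibre ⊆ circle
        image⊆circle z∈ with ∈-map⁻ (_* x₀⁻¹) z∈
        ... | x , x∈ , refl = ∈-filter⁺ (λ u → norm u ≟ 1#) (complete _) (begin
          norm (x * x₀⁻¹)        ≡⟨ pow-distrib-* x x₀⁻¹ (suc q) ⟩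
          norm x * norm x₀⁻¹     ≡⟨ cong (_* norm x₀⁻¹) (trans (proj₂ (∈-filter⁻ _ {xs = nonzero} x∈)) (sym norm[x₀]≡y)) ⟩
          norm x₀ * norm x₀⁻¹    ≡⟨ pow-distrib-* x₀ x₀⁻¹ (suc q) ⟨
          norm (x₀ * x₀⁻¹)       ≡⟨ cong norm x₀x₀⁻¹≡1 ⟩
          norm 1#                ≡⟨ pow-1# (suc q) ⟩
          1#                     ∎)

    circle-size : suc q ≤ length circle
    circle-size = q²-1≤[q-1]u⇒q<u 2≤q (begin
      q ℕ.* q ∸ 1                                           ≡⟨ cong (_∸ 1) (trans (sym 2^n≡q*q) (sym |nonzero|+1≡2^n)) ⟩
      length nonzero                                        ≤⟨ length≤∑-fibres _≟_ norm nonzero subfield× norm∈subfield× ⟩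
      ∑[ y ∈ subfield× ] count (λ x → norm x ≟ y) nonzero   ≤⟨ ∑-mono-≤ subfield× (λ {y} _ → fibre≤circle y) ⟩
      ∑[ y ∈ subfield× ] length circle                      ≡⟨ ∑-const (length circle) subfield× ⟩
      length subfield× ℕ.* length circle                    ≤⟨ ℕ.*-monoˡ-≤ (length circle) |subfield×|≤q-1 ⟩
      (q ∸ 1) ℕ.* length circle                             ∎)
      where open ℕ.≤-Reasoning

    agreements-on-circle : ∀ (f L : Carrier → Carrier) → f 0# ≡ L 0# → (∀ {u} → u ∈ circle → f u ≡ L u) →
                           dH f (λ x → L x + 0#) ℕ.+ (q ℕ.+ 2) ≤ 2 ^ n
    agreements-on-circle f L f≡L-at-0 f≡L-on-circle = begin
      dH f A ℕ.+ (q ℕ.+ 2)                ≡⟨ cong (dH f A ℕ.+_) (ℕ.+-comm q 2) ⟩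
      dH f A ℕ.+ suc (suc q)              ≤⟨ ℕ.+-monoʳ-≤ (dH f A) (s≤s circle-size) ⟩
      dH f A ℕ.+ length (0# ∷ circle)     ≤⟨ ℕ.+-monoʳ-≤ (dH f A) (length-mono-⊆ _≟_ 0∷circle! 0∷circle⊆agree) ⟩
      dH f A ℕ.+ agreements f A           ≡⟨ dH+agreements≡2^n f A ⟩
      2 ^ n                               ∎
      where
      open ℕ.≤-Reasoning
      A = λ x → L x + 0#
      0∷circle! : Unique (0# ∷ circle)
      0∷circle! = All.tabulate (λ u∈ 0≡u → circle-nonzero u∈ (sym 0≡u)) ∷ Unique.filter⁺ _ unique
      0∷circle⊆agree : (0# ∷ circle) ⊆ filter (λ x → f x ≟ A x) elements
      0∷circle⊆agree (here refl) = ∈-filter⁺ (λ x → f x ≟ A x) (complete 0#) (trans f≡L-at-0 (sym (+-identityʳ _)))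
      0∷circle⊆agree (there u∈)  = ∈-filter⁺ (λ x → f x ≟ A x) (complete _) (trans (f≡L-on-circle u∈) (sym (+-identityʳ _)))

  -- Difference equations of the inverse and Gold maps

  linear-0 : ∀ {L} → IsLinear L → L 0# ≡ 0#
  linear-0 {L} L-linear = trans (cong L (sym (+-identityʳ 0#))) (trans (L-linear 0# 0#) (x+x≡0 (L 0#)))

  count≤2 : ∀ {Q : Pred Carrier 0ℓ} (Q? : Decidable Q) a xs → Unique xs →
            (∀ {x y} → Q x → Q y → y ≡ x ⊎ y ≡ x + a) → count Q? xs ≤ 2
  count≤2 Q? a xs xs! related = within-coset (Unique.filter⁺ Q? xs!)
    (λ x∈ y∈ → related (proj₂ (∈-filter⁻ Q? {xs = xs} x∈)) (proj₂ (∈-filter⁻ Q? {xs = xs} y∈)))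
    where
    within-coset : ∀ {ys} → Unique ys → (∀ {x y} → x ∈ ys → y ∈ ys → y ≡ x ⊎ y ≡ x + a) → length ys ≤ 2
    within-coset {[]}     _   _       = z≤n
    within-coset {x ∷ ys} ys! related =
      length-mono-⊆ _≟_ {ys = x ∷ x + a ∷ []} ys! (λ y∈ → [ here , there ∘ here ]′ (related (here refl) y∈))

  quadratic-solutions : ∀ {a x y} → x * x + a * x ≡ y * y + a * y → y ≡ x ⊎ y ≡ x + a
  quadratic-solutions {a} {x} {y} same with zero-product (x + y) ((x + y) + a) factored
    where
    open ≡-Reasoning
    factored : (x + y) * ((x + y) + a) ≡ 0#
    factored = begin
      (x + y) * ((x + y) + a)
        ≡⟨ solve 3 (λ x y a → (x :+ y) :* ((x :+ y) :+ a)
                              := ((x :* x :+ a :* x) :+ (y :* y :+ a :* y)) :+ (x :* y :+ x :* y)) refl x y a ⟩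
      ((x * x + a * x) + (y * y + a * y)) + (x * y + x * y)      ≡⟨ cong₂ _+_ (cong (_+ (y * y + a * y)) same) (x+x≡0 (x * y)) ⟩
      ((y * y + a * y) + (y * y + a * y)) + 0#                   ≡⟨ trans (+-identityʳ _) (x+x≡0 _) ⟩
      0#                                                         ∎
  ... | inj₁ x+y≡0   = inj₁ (sym (+≡0⇒≡ x+y≡0))
  ... | inj₂ x+y+a≡0 = inj₂ (trans (sym (x+[x+y]≡y x y)) (cong (x +_) (+≡0⇒≡ x+y+a≡0)))

  module Inverse (2≤n : 2 ≤ n) where

    inv : Carrier → Carrier
    inv x = pow x (2 ^ n ∸ 2)

    inv-0 : inv 0# ≡ 0#
    inv-0 = pow-0# (ℕ.≤-trans (s≤s z≤n) (ℕ.∸-monoˡ-≤ 2 (ℕ.^-monoʳ-≤ 2 2≤n)))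

    x*inv[x]≡1 : ∀ {x} → x ≢ 0# → x * inv x ≡ 1#
    x*inv[x]≡1 {x} x≢0 = trans (cong (pow x) (sym (ℕ.+-∸-assoc 1 2≤2^n))) (fermat x≢0)
      where
      2≤2^n : 2 ≤ 2 ^ n
      2≤2^n = ℕ.^-monoʳ-≤ 2 (ℕ.≤-trans (s≤s z≤n) 2≤n)

    inv-unique : ∀ {x y} → x ≢ 0# → x * y ≡ 1# → inv x ≡ y
    inv-unique x≢0 xy≡1 = *-cancelˡ x≢0 (trans (x*inv[x]≡1 x≢0) (sym xy≡1))

    -- Away from 0 and a, clearing denominators turns x⁻¹ + (x + a)⁻¹ = b into a quadratic.
    inverse-difference-quadratic : ∀ {a b x} → x ≢ 0# → x + a ≢ 0# → inv x + inv (x + a) ≡ b →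
                                   b * (x * x + a * x) ≡ a
    inverse-difference-quadratic {a} {b} {x} x≢0 x+a≢0 sol = begin
      b * (x * x + a * x)                         ≡⟨ cong (_* (x * x + a * x)) sol ⟨
      (u + v) * (x * x + a * x)
        ≡⟨ solve 4 (λ x a u v → (u :+ v) :* (x :* x :+ a :* x) := (x :* u) :* (x :+ a) :+ ((x :+ a) :* v) :* x) refl x a u v ⟩
      (x * u) * (x + a) + ((x + a) * v) * x       ≡⟨ cong₂ (λ s t → s * (x + a) + t * x) (x*inv[x]≡1 x≢0) (x*inv[x]≡1 x+a≢0) ⟩
      1# * (x + a) + 1# * x                       ≡⟨ cong₂ _+_ (*-identityˡ _) (*-identityˡ x) ⟩
      (x + a) + x                                 ≡⟨ trans (+-comm _ x) (x+[x+y]≡y x a) ⟩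
      a                                           ∎
      where
      open ≡-Reasoning
      u = inv x
      v = inv (x + a)

    inverse-difference-at-0-or-a : ∀ {a b x} → a ≢ 0# → x ≡ 0# ⊎ x ≡ a → inv x + inv (x + a) ≡ b → a * b ≡ 1#
    inverse-difference-at-0-or-a {a} {b} a≢0 x≡0-or-a sol = trans (cong (a *_) (sym (inv[a]≡b x≡0-or-a sol))) (x*inv[x]≡1 a≢0)
      where
      open ≡-Reasoning
      inv[a]≡b : ∀ {x} → x ≡ 0# ⊎ x ≡ a → inv x + inv (x + a) ≡ b → inv a ≡ b
      inv[a]≡b (inj₁ refl) sol = begin
        inv a                    ≡⟨ +-identityˡ _ ⟨
        0# + inv a               ≡⟨ cong₂ _+_ inv-0 (cong inv (+-identityˡ a)) ⟨
        inv 0# + inv (0# + a)    ≡⟨ sol ⟩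
        b                        ∎
      inv[a]≡b (inj₂ refl) sol = begin
        inv a                    ≡⟨ +-identityʳ _ ⟨
        inv a + 0#               ≡⟨ cong (λ t → inv a + t) (trans (cong inv (x+x≡0 a)) inv-0) ⟨
        inv a + inv (a + a)      ≡⟨ sol ⟩
        b                        ∎

    inverse-differences : ∀ {a} b → a ≢ 0# → differences inv a b ≤ 2 ℕ.+ 2 ℕ.* 𝟙 ((a * b) ≟ 1#)
    inverse-differences {a} b a≢0 = begin
      count sol? elements                                          ≡⟨ count+count-∁ special? S ⟨
      count special? S ℕ.+ count (¬? ∘ special?) S
        ≡⟨ cong₂ ℕ._+_ (count-filter sol? special? elements) (count-filter sol? (¬? ∘ special?) elements) ⟩
      count (λ x → sol? x ×-dec special? x) elements ℕ.+ count (λ x → sol? x ×-dec ¬? (special? x)) elements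
                                                                   ≤⟨ ℕ.+-mono-≤ special-solutions generic-solutions ⟩
      2 ℕ.* 𝟙 ((a * b) ≟ 1#) ℕ.+ 2                                  ≡⟨ ℕ.+-comm _ 2 ⟩
      2 ℕ.+ 2 ℕ.* 𝟙 ((a * b) ≟ 1#)                                  ∎
      where
      open ℕ.≤-Reasoning
      sol? = λ x → (inv x + inv (x + a)) ≟ b
      special? = λ x → (x ≟ 0#) ⊎-dec (x ≟ a)
      S = filter sol? elements
      generic-solutions : count (λ x → sol? x ×-dec ¬? (special? x)) elements ≤ 2
      generic-solutions = count≤2 _ a elements unique (λ (solx , ¬spx) (soly , ¬spy) →
        quadratic-solutions (*-cancelˡ (b≢0 (quadratic solx ¬spx)) (trans (quadratic solx ¬spx) (sym (quadratic soly ¬spy)))))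
        where
        quadratic : ∀ {x} → inv x + inv (x + a) ≡ b → ¬ (x ≡ 0# ⊎ x ≡ a) → b * (x * x + a * x) ≡ a
        quadratic solx ¬spx = inverse-difference-quadratic (¬spx ∘ inj₁) (¬spx ∘ inj₂ ∘ +≡0⇒≡) solx
        b≢0 : ∀ {t} → b * t ≡ a → b ≢ 0#
        b≢0 {t} bt≡a refl = a≢0 (trans (sym bt≡a) (zeroˡ t))
      special-solutions : count (λ x → sol? x ×-dec special? x) elements ≤ 2 ℕ.* 𝟙 ((a * b) ≟ 1#)
      special-solutions with (a * b) ≟ 1#
      ... | yes _   = count≤2 _ a elements unique (λ (_ , spx) (_ , spy) → within-0-a spx spy)
        where
        within-0-a : ∀ {x y} → x ≡ 0# ⊎ x ≡ a → y ≡ 0# ⊎ y ≡ a → y ≡ x ⊎ y ≡ x + a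
        within-0-a (inj₁ refl) (inj₁ refl) = inj₁ refl
        within-0-a (inj₁ refl) (inj₂ refl) = inj₂ (sym (+-identityˡ a))
        within-0-a (inj₂ refl) (inj₁ refl) = inj₂ (sym (x+x≡0 a))
        within-0-a (inj₂ refl) (inj₂ refl) = inj₁ refl
      ... | no ab≢1 = ℕ.≤-reflexive (cong length (filter-none (λ x → sol? x ×-dec special? x) {xs = elements}
                        (All.tabulate (λ _ (solx , spx) → ab≢1 (inverse-difference-at-0-or-a a≢0 spx solx)))))

    self-inverse-points : ∀ {L} → IsLinear L →
                          suc (count (λ a → (a * L a) ≟ 1#) nonzero) ≤ agreements inv (λ x → L x + 0#)
    self-inverse-points {L} L-linear =
      length-mono-⊆ _≟_ (All.tabulate (λ a∈ 0≡a → ∈-nonzero⁻ (proj₁ (∈-filter⁻ self? {xs = nonzero} a∈)) (sym 0≡a))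
                          ∷ Unique.filter⁺ self? nonzero-unique) agree
      where
      self? = λ a → (a * L a) ≟ 1#
      agree? = λ x → inv x ≟ (L x + 0#)
      agree : (0# ∷ filter self? nonzero) ⊆ filter agree? elements
      agree (here refl) = ∈-filter⁺ agree? (complete 0#) (trans inv-0 (sym (trans (+-identityʳ _) (linear-0 L-linear))))
      agree (there a∈)  = ∈-filter⁺ agree? (complete _) (trans (inv-unique (∈-nonzero⁻ a∈nonzero) aLa≡1) (sym (+-identityʳ _)))
        where
        a∈nonzero = proj₁ (∈-filter⁻ self? {xs = nonzero} a∈)
        aLa≡1     = proj₂ (∈-filter⁻ self? {xs = nonzero} a∈)

    -- The pair count bounds N² by N + 2(2ⁿ − 1) + 2C, where C counts the nonzero a with a·L(a) = 1;
    -- since C < N₀ (the agreements with c = 0), either C < N or N ≤ C < N₀.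
    inverse-agreements-bound : ∀ {L} c → IsLinear L → let N = agreements inv (λ x → L x + c) in
                               (N ∸ 1) ℕ.* (N ∸ 2) ≤ length nonzero ℕ.* 2
    inverse-agreements-bound {L} c L-linear = by-cases (C ℕ.<? N)
      where
      N = agreements inv (λ x → L x + c)
      self? = λ a → (a * L a) ≟ 1#
      C = count self? nonzero
      M = length nonzero
      squared : ∀ c′ → let N′ = agreements inv (λ x → L x + c′) in N′ ℕ.* N′ ≤ N′ ℕ.+ (M ℕ.* 2 ℕ.+ 2 ℕ.* C)
      squared c′ = ℕ.≤-trans (agreements-squared inv c′ L-linear) (ℕ.+-monoʳ-≤ _ (begin
        ∑[ a ∈ nonzero ] differences inv a (L a)
          ≤⟨ ∑-mono-≤ nonzero (λ a∈ → inverse-differences (L _) (∈-nonzero⁻ a∈)) ⟩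
        ∑[ a ∈ nonzero ] (2 ℕ.+ 2 ℕ.* 𝟙 (self? a))
          ≡⟨ ∑-+ (λ _ → 2) (λ a → 2 ℕ.* 𝟙 (self? a)) nonzero ⟩
        ∑[ a ∈ nonzero ] 2 ℕ.+ ∑[ a ∈ nonzero ] (2 ℕ.* 𝟙 (self? a))
          ≡⟨ cong₂ ℕ._+_ (∑-const 2 nonzero) (∑-*ˡ 2 (𝟙 ∘ self?) nonzero) ⟩
        M ℕ.* 2 ℕ.+ 2 ℕ.* ∑[ a ∈ nonzero ] 𝟙 (self? a)
          ≡⟨ cong (λ t → M ℕ.* 2 ℕ.+ 2 ℕ.* t) (count≡∑𝟙 self? nonzero) ⟨
        M ℕ.* 2 ℕ.+ 2 ℕ.* C
          ∎))
        where open ℕ.≤-Reasoning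
      by-cases : Dec (C < N) → (N ∸ 1) ℕ.* (N ∸ 2) ≤ length nonzero ℕ.* 2
      by-cases (yes C<N) = pairs-bound-inverse {M = length nonzero} (squared c) C<N
      by-cases (no C≮N)  = ℕ.≤-trans (ℕ.*-mono-≤ (ℕ.∸-monoˡ-≤ 1 N≤N₀) (ℕ.∸-monoˡ-≤ 2 N≤N₀))
                                    (pairs-bound-inverse {M = length nonzero} (squared 0#) C<N₀)
        where
        C<N₀ = self-inverse-points L-linear
        N≤N₀ = ℕ.≤-trans (ℕ.≮⇒≥ C≮N) (ℕ.<⇒≤ C<N₀)

    inverse-near-frobenius : ∀ {m} (n≡m+m : n ≡ m ℕ.+ m) (1≤m : 1 ≤ m) → let open UnitCircle n≡m+m 1≤m in
                             dH inv (λ x → pow x q + 0#) ℕ.+ (q ℕ.+ 2) ≤ 2 ^ n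
    inverse-near-frobenius {m} n≡m+m 1≤m = agreements-on-circle inv (λ x → pow x q)
      (trans inv-0 (sym (pow-0# (ℕ.m^n>0 2 m)))) (λ u∈ → inv-unique (circle-nonzero u∈) (∈-circle⁻ u∈))
      where open UnitCircle n≡m+m 1≤m

  pow-2^-2^ : ∀ x a b → pow (pow x (2 ^ a)) (2 ^ b) ≡ pow x (2 ^ (a ℕ.+ b))
  pow-2^-2^ x a b = trans (sym (pow-* x (2 ^ a) (2 ^ b))) (cong (pow x) (sym (ℕ.^-distribˡ-+-* 2 a b)))

  frobenius-fixed-iterate : ∀ {x} a → pow x (2 ^ a) ≡ x → ∀ j → pow x (2 ^ (j ℕ.* a)) ≡ x
  frobenius-fixed-iterate {x} a fixed zero    = *-identityʳ x
  frobenius-fixed-iterate {x} a fixed (suc j) = begin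
    pow x (2 ^ (a ℕ.+ j ℕ.* a))               ≡⟨ pow-2^-2^ x a (j ℕ.* a) ⟨
    pow (pow x (2 ^ a)) (2 ^ (j ℕ.* a))       ≡⟨ cong (λ z → pow z (2 ^ (j ℕ.* a))) fixed ⟩
    pow x (2 ^ (j ℕ.* a))                     ≡⟨ frobenius-fixed-iterate a fixed j ⟩
    x                                         ∎
    where open ≡-Reasoning

  module Gold {k s : ℕ} (k≡2s+1 : k ≡ 2 ℕ.* s ℕ.+ 1) (n≡m+m : n ≡ suc k ℕ.+ suc k) where

    σ : Carrier → Carrier
    σ x = pow x (2 ^ k)

    gold : Carrier → Carrier
    gold x = pow x (2 ^ k ℕ.+ 1)

    -- σ fixes w, hence so does σ² = (x ↦ x^(2^(2k))) and thus x ↦ x⁴ = x^(2^(n − 2k));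
    -- as k is odd, σ then acts on w as squaring.
    σ-fixed⇒1 : ∀ {w} → w ≢ 0# → σ w ≡ w → w ≡ 1#
    σ-fixed⇒1 {w} w≢0 σw≡w = *-cancelˡ w≢0 (begin
      w * w                          ≡⟨ pow-two w ⟨
      pow w 2                        ≡⟨ cong (λ z → pow z 2) (frobenius-fixed-iterate 2 w⁴≡w s) ⟨
      pow (pow w (2 ^ (s ℕ.* 2))) 2  ≡⟨ trans (cong (λ z → pow (pow w (2 ^ z)) 2) (ℕ.*-comm s 2)) (pow-2^-2^ w (2 ℕ.* s) 1) ⟩
      pow w (2 ^ (2 ℕ.* s ℕ.+ 1))    ≡⟨ cong (λ e → pow w (2 ^ e)) (sym k≡2s+1) ⟩
      σ w                            ≡⟨ σw≡w ⟩
      w                              ≡⟨ *-identityʳ w ⟨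
      w * 1#                         ∎)
      where
      open ≡-Reasoning
      σ²w≡w : pow w (2 ^ (k ℕ.+ k)) ≡ w
      σ²w≡w = trans (sym (pow-2^-2^ w k k)) (trans (cong σ σw≡w) σw≡w)
      w⁴≡w : pow w (2 ^ 2) ≡ w
      w⁴≡w = begin
        pow w (2 ^ 2)                           ≡⟨ cong (λ z → pow z (2 ^ 2)) σ²w≡w ⟨
        pow (pow w (2 ^ (k ℕ.+ k))) (2 ^ 2)     ≡⟨ pow-2^-2^ w (k ℕ.+ k) 2 ⟩
        pow w (2 ^ (k ℕ.+ k ℕ.+ 2))             ≡⟨ cong (λ e → pow w (2 ^ e)) k+k+2≡n ⟩
        pow w (2 ^ n)                           ≡⟨ pow-2^n w ⟩
        w                                       ∎
        where
        k+k+2≡n : k ℕ.+ k ℕ.+ 2 ≡ n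
        k+k+2≡n = trans (ℕ.+-comm (k ℕ.+ k) 2) (sym (trans n≡m+m (cong suc (ℕ.+-suc k k))))

    gold-difference : ∀ x a → gold x + gold (x + a) ≡ (σ x * a + σ a * x) + σ a * a
    gold-difference x a = begin
      gold x + gold (x + a)                              ≡⟨ cong₂ _+_ (gold≡σx*x x) (gold≡σx*x (x + a)) ⟩
      σ x * x + σ (x + a) * (x + a)                      ≡⟨ cong (λ t → σ x * x + t * (x + a)) (frobenius-isLinear k x a) ⟩
      σ x * x + (σ x + σ a) * (x + a)
        ≡⟨ solve 4 (λ X x A a → X :* x :+ (X :+ A) :* (x :+ a)
                                := (X :* x :+ X :* x) :+ ((X :* a :+ A :* x) :+ A :* a)) refl (σ x) x (σ a) a ⟩
      (σ x * x + σ x * x) + ((σ x * a + σ a * x) + σ a * a)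
        ≡⟨ trans (cong (_+ ((σ x * a + σ a * x) + σ a * a)) (x+x≡0 (σ x * x))) (+-identityˡ _) ⟩
      (σ x * a + σ a * x) + σ a * a                      ∎
      where
      open ≡-Reasoning
      gold≡σx*x : ∀ x → gold x ≡ σ x * x
      gold≡σx*x x = trans (pow-+ x (2 ^ k) 1) (cong (σ x *_) (*-identityʳ x))

    -- x ↦ gold x + gold (x + a) is affine, and its linear part x ↦ σ x · a + σ a · x has kernel {0, a}.
    gold-difference-solutions : ∀ {a x y} → a ≢ 0# → gold x + gold (x + a) ≡ gold y + gold (y + a) →
                                y ≡ x ⊎ y ≡ x + a
    gold-difference-solutions {a} {x} {y} a≢0 same with (x + y) ≟ 0#
    ... | yes x+y≡0 = inj₁ (sym (+≡0⇒≡ x+y≡0))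
    ... | no x+y≢0  = inj₂ (trans (sym (x+[x+y]≡y x y)) (cong (x +_) z≡a))
      where
      open ≡-Reasoning
      z = x + y
      a⁻¹ = proj₁ (inverse a a≢0)
      aa⁻¹≡1 = proj₂ (inverse a a≢0)
      w = z * a⁻¹
      z≡w*a : z ≡ w * a
      z≡w*a = sym (trans (*-assoc z a⁻¹ a) (trans (cong (z *_) (trans (*-comm a⁻¹ a) aa⁻¹≡1)) (*-identityʳ z)))
      w≢0 : w ≢ 0#
      w≢0 w≡0 = x+y≢0 (trans z≡w*a (trans (cong (_* a) w≡0) (zeroˡ a)))
      σz*a≡σa*z : σ z * a ≡ σ a * z
      σz*a≡σa*z = +≡0⇒≡ (begin
        σ z * a + σ a * z                            ≡⟨ cong (λ t → t * a + σ a * z) (frobenius-isLinear k x y) ⟩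
        (σ x + σ y) * a + σ a * (x + y)
          ≡⟨ solve 6 (λ X Y a A x y → (X :+ Y) :* a :+ A :* (x :+ y) := (X :* a :+ A :* x) :+ (Y :* a :+ A :* y))
                     refl (σ x) (σ y) a (σ a) x y ⟩
        (σ x * a + σ a * x) + (σ y * a + σ a * y)    ≡⟨ cong (_+ (σ y * a + σ a * y)) linear-parts-equal ⟩
        (σ y * a + σ a * y) + (σ y * a + σ a * y)    ≡⟨ x+x≡0 _ ⟩
        0#                                           ∎)
        where
        linear-parts-equal : σ x * a + σ a * x ≡ σ y * a + σ a * y
        linear-parts-equal = +-cancelˡ (σ a * a) (trans (+-comm _ _) (trans (sym (gold-difference x a))
                               (trans same (trans (gold-difference y a) (+-comm _ _)))))
      σw≡w : σ w ≡ w
      σw≡w = *-cancelʳ a≢0 (*-cancelˡ (pow-nonzero (2 ^ k) a≢0) (begin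
        σ a * (σ w * a)      ≡⟨ solve 3 (λ A W a → A :* (W :* a) := (W :* A) :* a) refl (σ a) (σ w) a ⟩
        (σ w * σ a) * a      ≡⟨ cong (_* a) (trans (sym (pow-distrib-* w a (2 ^ k))) (cong σ (sym z≡w*a))) ⟩
        σ z * a              ≡⟨ σz*a≡σa*z ⟩
        σ a * z              ≡⟨ cong (σ a *_) z≡w*a ⟩
        σ a * (w * a)        ∎))
      z≡a : z ≡ a
      z≡a = trans z≡w*a (trans (cong (_* a) (σ-fixed⇒1 w≢0 σw≡w)) (*-identityˡ a))

    gold-differences : ∀ {a} b → a ≢ 0# → differences gold a b ≤ 2
    gold-differences {a} b a≢0 = count≤2 _ a elements unique (λ solx soly → gold-difference-solutions a≢0 (trans solx (sym soly)))

    gold-agreements-bound : ∀ {L} c → IsLinear L → let N = agreements gold (λ x → L x + c) in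
                            N ℕ.* (N ∸ 1) ≤ length nonzero ℕ.* 2
    gold-agreements-bound {L} c L-linear = pairs-bound-APN {M = length nonzero} (ℕ.≤-trans (agreements-squared gold c L-linear)
      (ℕ.+-monoʳ-≤ _ (ℕ.≤-trans (∑-mono-≤ nonzero (λ a∈ → gold-differences (L _) (∈-nonzero⁻ a∈)))
                                 (ℕ.≤-reflexive (∑-const 2 nonzero)))))

    gold-near-frobenius : let open UnitCircle n≡m+m (s≤s z≤n) in
                          dH gold (λ x → pow x (2 ^ (n ∸ 1)) + 0#) ℕ.+ (q ℕ.+ 2) ≤ 2 ^ n
    gold-near-frobenius = agreements-on-circle gold (λ x → pow x (2 ^ (n ∸ 1)))
      (trans (pow-0# (ℕ.m≤n+m 1 (2 ^ k))) (sym (pow-0# (ℕ.m^n>0 2 (n ∸ 1))))) gold≡square-root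
      where
      open UnitCircle n≡m+m (s≤s z≤n)
      open ≡-Reasoning
      gold≡square-root : ∀ {u} → u ∈ circle → gold u ≡ pow u (2 ^ (n ∸ 1))
      gold≡square-root {u} u∈ = begin
        gold u                              ≡⟨ pow-2^n (gold u) ⟨
        pow (gold u) (2 ^ n)                ≡⟨ cong (λ e → pow (gold u) (2 ^ e)) n≡1+[n-1] ⟩
        pow (gold u) (2 ℕ.* 2 ^ (n ∸ 1))    ≡⟨ pow-* (gold u) 2 (2 ^ (n ∸ 1)) ⟩
        pow (pow (gold u) 2) (2 ^ (n ∸ 1))  ≡⟨ cong (λ z → pow z (2 ^ (n ∸ 1))) gold[u]²≡u ⟩
        pow u (2 ^ (n ∸ 1))                 ∎
        where
        n≡1+[n-1] : n ≡ suc (n ∸ 1)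
        n≡1+[n-1] = sym (ℕ.m+[n∸m]≡n (subst (1 ≤_) (sym n≡m+m) (s≤s z≤n)))
        gold[u]²≡u : pow (gold u) 2 ≡ u
        gold[u]²≡u = begin
          pow (gold u) 2                       ≡⟨ pow-* u (2 ^ k ℕ.+ 1) 2 ⟨
          pow u ((2 ^ k ℕ.+ 1) ℕ.* 2)          ≡⟨ cong (pow u) ([2ᵏ+1]*2≡2ᵏ⁺¹+1+1 k) ⟩
          pow u (suc q ℕ.+ 1)                  ≡⟨ pow-+ u (suc q) 1 ⟩
          norm u * pow u 1                     ≡⟨ cong₂ _*_ (∈-circle⁻ u∈) (*-identityʳ u) ⟩
          1# * u                               ≡⟨ *-identityˡ u ⟩
          u                                    ∎

open import Data.Nat using (_+_; _*_)
open import Data.Nat.Divisibility using (_∣_; divides)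
open import Data.Integer as ℤ using (+_; _-_)
import Data.Integer.Properties as ℤ
open import Data.Product using (_×_)
open Arithmetic

add-weaker-bound : ∀ {n} (F : BinaryField n) → let open BinaryField F in
                   ∀ {A : Set} {f i} → A × dHA≤ f (i - + 2) → A × dHA≤ f (i - + 2) × dHA≤ f (i - + 1)
add-weaker-bound F {i = i} (a , (L , L-linear , c , d≤i-2)) =
  a , (L , L-linear , c , d≤i-2) , (L , L-linear , c , ℤ.≤-trans d≤i-2 (ℤ.+-monoʳ-≤ i (ℤ.neg-mono-≤ (ℤ.+≤+ (s≤s z≤n)))))

inverse-distance : ∀ {n m} → n ≡ m + m → 1 ≤ m → (F : BinaryField n) → let open BinaryField F in
                   dHA-all (λ x → pow x (2 ^ n ∸ 2)) (LowerBound n 3)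
                   × dHA≤ (λ x → pow x (2 ^ n ∸ 2)) (+ (2 ^ n) - + (2 ^ (n / 2)) - + 2)
inverse-distance {n} {m} n≡m+m 1≤m F = lower , upper
  where
  open BinaryField F using (pow; dH; dHA≤; dHA-all; 0#)
  open GaloisField F
  open Inverse (subst (2 ≤_) (sym n≡m+m) (ℕ.+-mono-≤ 1≤m 1≤m))
  lower : dHA-all inv (LowerBound n 3)
  lower L L-linear c = agreements⇒LowerBound {m} 1 inv L c n≡m+m (inverse-agreements-bound c L-linear)
  upper : dHA≤ inv (+ (2 ^ n) - + (2 ^ (n / 2)) - + 2)
  upper = (λ x → pow x (2 ^ m)) , frobenius-isLinear m , 0# ,
          +d≤+b-+a-+k 2 (cong (2 ^_) (trans (sym (half-double m)) (cong (_/ 2) (sym n≡m+m)))) (inverse-near-frobenius n≡m+m 1≤m)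

gold-distance : ∀ {n s} → n ≡ suc s * 4 → (d : ℕ) → d ≡ 2 ^ (n / 2 ∸ 1) + 1 → (F : BinaryField n) →
                let open BinaryField F in
                dHA-all (λ x → pow x d) (LowerBound n 1)
                × dHA≤ (λ x → pow x d) (+ (2 ^ n) - + (2 ^ (n / 2)) - + 2)
gold-distance {n} {s} n≡[s+1]*4 d d≡ F = subst bounds (sym (trans d≡ (cong (λ e → 2 ^ e + 1) n/2-1≡k))) (lower , upper)
  where
  open BinaryField F using (pow; dH; dHA≤; dHA-all; 0#)
  open GaloisField F
  bounds : ℕ → Set
  bounds e = dHA-all (λ x → pow x e) (LowerBound n 1) × dHA≤ (λ x → pow x e) (+ (2 ^ n) - + (2 ^ (n / 2)) - + 2)
  k : ℕ
  k = 2 * s + 1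
  n≡m+m : n ≡ suc k + suc k
  n≡m+m = trans n≡[s+1]*4 ([s+1]*4≡[2s+2]+[2s+2] s)
  n/2≡k+1 : n / 2 ≡ suc k
  n/2≡k+1 = trans (cong (_/ 2) n≡m+m) (half-double (suc k))
  n/2-1≡k : n / 2 ∸ 1 ≡ k
  n/2-1≡k = cong (_∸ 1) n/2≡k+1
  open Gold {k} {s} refl n≡m+m
  lower : dHA-all gold (LowerBound n 1)
  lower L L-linear c = agreements⇒LowerBound {suc k} 0 gold L c n≡m+m (gold-agreements-bound c L-linear)
  upper : dHA≤ gold (+ (2 ^ n) - + (2 ^ (n / 2)) - + 2)
  upper = (λ x → pow x (2 ^ (n ∸ 1))) , frobenius-isLinear (n ∸ 1) , 0# ,
          +d≤+b-+a-+k 2 (cong (2 ^_) (sym n/2≡k+1)) gold-near-frobenius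

theorem2 : (n : ℕ) → n > 0 →
    ((2 ∣ n) → (F : BinaryField n) → let open BinaryField F in
       dHA-all (λ x → pow x (2 ^ n ∸ 2)) (LowerBound n 3)
       × dHA≤ (λ x → pow x (2 ^ n ∸ 2)) (+ (2 ^ n) - + (2 ^ (n / 2)) - + 2)
       × dHA≤ (λ x → pow x (2 ^ n ∸ 2)) (+ (2 ^ n) - + (2 ^ (n / 2)) - + 1))
  × ((4 ∣ n) → (d : ℕ) → d ≡ 2 ^ (n / 2 ∸ 1) + 1 → (F : BinaryField n) → let open BinaryField F in
       dHA-all (λ x → pow x d) (LowerBound n 1)
       × dHA≤ (λ x → pow x d) (+ (2 ^ n) - + (2 ^ (n / 2)) - + 2)
       × dHA≤ (λ x → pow x d) (+ (2 ^ n) - + (2 ^ (n / 2)) - + 1))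
theorem2 n n>0 =
  (λ { (divides zero n≡0) → ⊥-elim (ℕ.<-irrefl (sym n≡0) n>0)
     ; (divides (suc m) n≡[m+1]*2) F →
         add-weaker-bound F {i = + (2 ^ n) - + (2 ^ (n / 2))} (inverse-distance (trans n≡[m+1]*2 (m*2≡m+m (suc m))) (s≤s z≤n) F) }) ,
  (λ { (divides zero n≡0) → ⊥-elim (ℕ.<-irrefl (sym n≡0) n>0)
     ; (divides (suc s) n≡[s+1]*4) d d≡ F →
         add-weaker-bound F {i = + (2 ^ n) - + (2 ^ (n / 2))} (gold-distance {s = s} n≡[s+1]*4 d d≡ F) })
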